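{- If a Tangle has length $4c$, then its Fleron polyomino has perimeter $4c$.
   Context: Fix $r>0$ and consider the circles of radius $r$ centered at the points of $L_1=2\sqrt2\,r\,\mathbb Z^2$ and of $L_2=2\sqrt2\,r\,(\mathbb Z^2+(\tfrac12,\tfrac12))$ (a square packing of the plane in which each circle is tangent to four others at its NE, NW, SW, SE points). A (planar) Tangle is a smooth simple closed plane curve that is a finite union of links, each link being a quarter of one of these circles joining two consecutive intercardinal points of that circle. The length of a Tangle is its number of links. Dual graph: the circles of the packing that contain a link of $T$ and whose disks lie in the closed region bounded by $T$ all have centers in the same one of $L_1,L_2$; call it $L_T$. The vertices of the dual graph are the points of $L_T$ that are centers of circles whose disks lie in the closed region bounded by $T$; two vertices are joined by an edge if they differ by $(\pm2\sqrt2 r,0)$ or $(0,\pm2\sqrt2 r)$ and the segment joining them does not meet $T$. A square of the dual graph is a set of four vertices forming the corners of a square of side $2\sqrt2 r$ all four of whose sides are edges. Fleron polyomino: fixing $p\in L_T$, identify each vertex $v$ with $(i,j)=(v-p)/(2\sqrt2 r)\in\mathbb Z^2$. The Fleron polyomino of $T$ is the union of the unit cells: $[2i,2i+1]\times[2j,2j+1]$ for each vertex $(i,j)$; $[2i+1,2i+2]\times[2j,2j+1]$ for each edge between $(i,j)$ and $(i+1,j)$; $[2i,2i+1]\times[2j+1,2j+2]$ for each edge between $(i,j)$ and $(i,j+1)$; and $[2i+1,2i+2]\times[2j+1,2j+2]$ for each square with corners $(i,j),(i+1,j),(i,j+1),(i+1,j+1)$. Its perimeter is the number of unit cell edges on its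 boundary. -}

module Defs where

-- Coordinate conventions:
--  * Plane coordinates are measured in the unit s = √2·r.  The circle centres of the
--    packing are then the integer points (a , b) with a , b both even (lattice L₁)
--    or both odd (lattice L₂); every circle has radius 1/√2 in these units.
--  * Intercardinal (tangency) points are half-integral; we record them in doubled
--    coordinates: the NE point of the circle centred at (a , b) is (2a+1 , 2b+1), etc.

open import Data.Bool using (Bool; true; false; _∧_)
open import Data.Nat as ℕ using (ℕ; zero; suc; _%_)
open import Data.Integer as ℤ using (ℤ; +_; _+_; _-_; _*_; -_; _≤?_; _<?_; _≟_)
open import Data.Product using (Σ; _×_; _,_; ∃; ∃-syntax; proj₁; proj₂)
open import Data.Sum using (_⊎_)
open import Data.List using (List; []; _∷_; _++_; [_]; map; length)
open import Data.List.Relation.Unary.Any using (Any)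
open import Data.List.Relation.Unary.All using (All)
open import Data.List.Relation.Unary.Linked using (Linked)
open import Data.List.Relation.Unary.Unique.Propositional using (Unique)
open import Data.List.Membership.Propositional using (_∈_)
open import Relation.Binary.PropositionalEquality using (_≡_)
open import Relation.Nullary using (¬_)
open import Relation.Nullary.Decidable using (⌊_⌋)
open import Function.Bundles using (_⇔_)

Point : Set
Point = ℤ × ℤ

_⊕_ : Point → Point → Point
(a , b) ⊕ (c , d) = (a + c , b + d)

EvenZ : ℤ → Set
EvenZ z = ∃[ k ] (z ≡ k + k)

OddZ : ℤ → Set
OddZ z = ∃[ k ] (z ≡ + 1 + (k + k))

data Lattice : Set where
  L₁ L₂ : Lattice

InLattice : Lattice → Point → Set
InLattice L₁ (a , b) = EvenZ a × EvenZ b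
InLattice L₂ (a , b) = OddZ a × OddZ b

IsCentre : Point → Set
IsCentre p = InLattice L₁ p ⊎ InLattice L₂ p

data Quad : Set where
  qN qE qS qW : Quad

data ICP : Set where
  NE NW SW SE : ICP

offset : ICP → Point
offset NE = (+ 1 , + 1)
offset NW = (- + 1 , + 1)
offset SW = (- + 1 , - + 1)
offset SE = (+ 1 , - + 1)

ccwStart ccwEnd : Quad → ICP
ccwStart qN = NE
ccwStart qW = NW
ccwStart qS = SW
ccwStart qE = SE
ccwEnd qN = NW
ccwEnd qW = SW
ccwEnd qS = SE
ccwEnd qE = NE

-- an oriented link: a quarter of the circle centred at 'centre', traversed
-- counterclockwise (ccw = true) or clockwise (ccw = false)
record OLink : Set where
  constructor olink
  field
    centre : Point
    quad   : Quad
    ccw    : Bool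
open OLink public

startICP endICP : OLink → ICP
startICP (olink _ q true)  = ccwStart q
startICP (olink _ q false) = ccwEnd q
endICP (olink _ q true)  = ccwEnd q
endICP (olink _ q false) = ccwStart q

position : Point → ICP → Point
position (a , b) i = (+ 2 * a , + 2 * b) ⊕ offset i

startPt endPt : OLink → Point
startPt l = position (centre l) (startICP l)
endPt l = position (centre l) (endICP l)

tangentAt : Bool → ICP → Point
tangentAt true  i = (- proj₂ (offset i) , proj₁ (offset i))
tangentAt false i = (proj₂ (offset i) , - proj₁ (offset i))

startTangent endTangent : OLink → Point
startTangent l = tangentAt (ccw l) (startICP l)
endTangent l = tangentAt (ccw l) (endICP l)

-- l is followed by m along the curve: they meet at the endpoint of l, and the
-- curve is smooth (C¹, continuous unit tangent) there
Joins : OLink → OLink → Set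
Joins l m = (endPt l ≡ startPt m) × (endTangent l ≡ startTangent m)

record Tangle : Set where
  field
    first     : OLink
    rest      : List OLink
    centresOK : All (λ l → IsCentre (centre l)) (first ∷ rest)
    closed    : Linked Joins (first ∷ rest ++ [ first ])
    simple    : Unique (map startPt (first ∷ rest))

links : Tangle → List OLink
links T = Tangle.first T ∷ Tangle.rest T

tangleLength : Tangle → ℕ
tangleLength T = length (links T)

countᵇ : {A : Set} → (A → Bool) → List A → ℕ
countᵇ f [] = 0
countᵇ f (x ∷ xs) with f x
... | true  = suc (countᵇ f xs)
... | false = countᵇ f xs

-- does the link l meet the horizontal ray starting at the centre point p and going
-- to the right?  (It meets it, transversally, iff l is the E quarter of a circle
-- on the same row weakly to the right, or the W quarter of one strictly to the right.)
crossesRayᵇ : Point → OLink → Bool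
crossesRayᵇ (a , b) (olink (a' , b') qE _) = ⌊ b' ≟ b ⌋ ∧ ⌊ a ≤? a' ⌋
crossesRayᵇ (a , b) (olink (a' , b') qW _) = ⌊ b' ≟ b ⌋ ∧ ⌊ a <? a' ⌋
crossesRayᵇ _ _ = false

-- the disk of the packing circle centred at p lies in the closed region bounded by T
-- (equivalently, p lies in the bounded component of the complement of T;
--  decided by the parity of the number of crossings of a ray)
DiskInside : Tangle → Point → Set
DiskInside T p = countᵇ (crossesRayᵇ p) (links T) % 2 ≡ 1

HasLink : Tangle → Point → Quad → Set
HasLink T c q = Any (λ l → (centre l ≡ c) × (quad l ≡ q)) (links T)

-- ℓ is the lattice L_T: it contains the centres of the circles carrying a link of T
-- whose disks lie in the closed region bounded by T
IsLT : Tangle → Lattice → Set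
IsLT T ℓ = ∃[ l ] ((l ∈ links T) × DiskInside T (centre l) × InLattice ℓ (centre l))

-- dual graph (with respect to the lattice ℓ = L_T); neighbouring vertices differ by
-- (±2 , 0) or (0 , ±2) in our units (= 2√2 r)
Vertex : Tangle → Lattice → Point → Set
Vertex T ℓ v = InLattice ℓ v × DiskInside T v

-- the segment from v to v + (2,0) meets T iff T contains the E quarter of the circle
-- at v or the W quarter of the circle at v + (2,0)
HEdge : Tangle → Lattice → Point → Set
HEdge T ℓ v = Vertex T ℓ v × Vertex T ℓ (v ⊕ (+ 2 , + 0))
  × ¬ (HasLink T v qE ⊎ HasLink T (v ⊕ (+ 2 , + 0)) qW)

VEdge : Tangle → Lattice → Point → Set
VEdge T ℓ v = Vertex T ℓ v × Vertex T ℓ (v ⊕ (+ 0 , + 2))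
  × ¬ (HasLink T v qN ⊎ HasLink T (v ⊕ (+ 0 , + 2)) qS)

DSquare : Tangle → Lattice → Point → Set
DSquare T ℓ v = HEdge T ℓ v × HEdge T ℓ (v ⊕ (+ 0 , + 2))
  × VEdge T ℓ v × VEdge T ℓ (v ⊕ (+ 2 , + 0))

-- A polyomino is given by its set of unit cells, a cell being named by its
-- lower-left corner.
-- Fleron polyomino of T w.r.t. ℓ = L_T and base point p ∈ L_T; vertex v = p + 2(i,j)
-- is identified with (i , j).
FleronAt : Tangle → Lattice → Point → Point → ℤ → ℤ → Set
FleronAt T ℓ p (X , Y) i j =
     (Vertex T ℓ v × ((X , Y) ≡ (+ 2 * i , + 2 * j)))
   ⊎ (HEdge T ℓ v × ((X , Y) ≡ (+ 2 * i + + 1 , + 2 * j)))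
   ⊎ (VEdge T ℓ v × ((X , Y) ≡ (+ 2 * i , + 2 * j + + 1)))
   ⊎ (DSquare T ℓ v × ((X , Y) ≡ (+ 2 * i + + 1 , + 2 * j + + 1)))
  where
  v : Point
  v = p ⊕ (+ 2 * i , + 2 * j)

Fleron : Tangle → Lattice → Point → Point → Set
Fleron T ℓ p X = ∃[ i ] ∃[ j ] FleronAt T ℓ p X i j

-- unit edges of the square grid: hor x y = segment (x,y)–(x+1,y);
-- ver x y = segment (x,y)–(x,y+1)
data UnitEdge : Set where
  hor ver : ℤ → ℤ → UnitEdge

OnBoundary : (Point → Set) → UnitEdge → Set
OnBoundary P (hor x y) = (P (x , y) × ¬ P (x , y - + 1)) ⊎ (¬ P (x , y) × P (x , y - + 1))
OnBoundary P (ver x y) = (P (x , y) × ¬ P (x - + 1 , y)) ⊎ (¬ P (x , y) × P (x - + 1 , y))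

HasPerimeter : (Point → Set) → ℕ → Set
HasPerimeter P n = ∃[ es ] (Unique es × (∀ e → (e ∈ es) ⇔ OnBoundary P e) × (length es ≡ n))

{-# OPTIONS --safe #-}

-- Measure the plane in units of √2·r. Circle centres are then the integer
-- points whose coordinates have equal parity; the other integer points are the
-- centres of the gaps between four mutually tangent circles. Shifting by p, the
-- Fleron cell with lower-left corner Z corresponds to the integer point p + Z
-- (vertices and squares of the dual graph to centres, edges to gaps), and the
-- cell belongs to the polyomino exactly when that point lies inside T.
-- Insideness is the parity of the crossings of a rightward ray. Passing to a
-- horizontally or vertically adjacent integer point changes it exactly when a
-- link separates the two points, a link being the quarter circle separating its
-- centre from one adjacent gap; so the boundary edges of the polyomino are in
-- bijection with the links.
-- Identifying cells with inside points rests on two facts: a circle carrying a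
-- link has its centre inside T iff the centre lies in L_T (this propagates along
-- T, since where T changes circle both the side and the lattice change), and no
-- circle outside L_T carries all four of its quarters (T would be that circle).

module Submission where

open import Defs

open import Algebra.Bundles using (CommutativeRing)
open import Data.Bool using (Bool; true; false; not; _∧_; _xor_)
open import Data.Bool.Properties
  using ( not-involutive; not-¬; ¬-not; not-distribʳ-xor; xor-comm; xor-same; xor-identityʳ
        ; ∧-distribˡ-xor; xor-∧-commutativeRing )
open import Data.Empty using (⊥-elim)
open import Data.Integer using (ℤ; +_; -[1+_]; _+_; _-_; -_; _*_; _≤_; _<_; _≤?_; _<?_; _≟_)
import Data.Integer.Properties as ℤ
open import Data.Integer.Tactic.RingSolver using (solve-∀)
open import Data.List using (List; []; _∷_; _++_; [_]; map)
open import Data.List.Properties using (length-map)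
open import Data.List.Membership.Propositional using (_∈_; find; lose)
open import Data.List.Membership.Propositional.Properties using (∈-map⁺; ∈-map⁻; ∈-++⁺ˡ)
open import Data.List.Relation.Unary.All as All using (All; []; _∷_)
open import Data.List.Relation.Unary.All.Properties using () renaming (map⁺ to All-map⁺)
open import Data.List.Relation.Unary.AllPairs using ([]; _∷_)
open import Data.List.Relation.Unary.Any using (here; there)
open import Data.List.Relation.Unary.Linked using (Linked; [-]; _∷_)
open import Data.List.Relation.Unary.Unique.Propositional using (Unique)
import Data.List.Relation.Unary.Unique.Propositional.Properties as Unique
import Data.List.Relation.Binary.Permutation.Propositional as ↭
open ↭ using (_↭_; ↭-sym; ↭⇒↭ₛ)
import Data.List.Relation.Binary.Permutation.Propositional.Properties as ↭
open import Data.List.Relation.Binary.Permutation.Propositional.Properties using (∷↭∷ʳ; ∈-resp-↭)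
import Data.List.Relation.Binary.Permutation.Setoid.Properties as ↭ₛ
open import Data.Nat using (ℕ; zero; suc; _%_)
import Data.Nat as ℕ
import Data.Nat.Properties as ℕ
open import Data.Product using (_×_; _,_; ∃; ∃-syntax; proj₁; proj₂)
import Data.Product as Product
open import Data.Product.Properties using (≡-dec)
open import Data.Sum using (_⊎_; inj₁; inj₂; [_,_]′)
import Data.Sum as Sum
open import Function.Base using (_∘_; id)
open import Function.Bundles using (_⇔_; mk⇔; Equivalence)
open import Function.Construct.Composition using () renaming (equivalence to ⇔-trans)
open import Function.Construct.Symmetry using (⇔-sym)
open import Relation.Binary.Definitions using (DecidableEquality)
open import Relation.Binary.PropositionalEquality
  using (_≡_; _≢_; refl; sym; trans; cong; cong₂; subst; subst₂; module ≡-Reasoning)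
open import Relation.Binary.PropositionalEquality.Properties using (setoid)
open import Relation.Nullary using (¬_)
open import Relation.Nullary.Decidable using (Dec; yes; no; map′; ⌊_⌋)

open import Algebra.Properties.CommutativeSemigroup
  (CommutativeRing.+-commutativeSemigroup xor-∧-commutativeRing)
  using () renaming (interchange to xor-interchange; x∙yz≈y∙xz to xor-left-comm)

isOdd : ℕ → Bool
isOdd zero    = false
isOdd (suc n) = not (isOdd n)

%2≡1⇔isOdd : ∀ n → (n % 2 ≡ 1) ⇔ (isOdd n ≡ true)
%2≡1⇔isOdd 0 = mk⇔ (λ ()) (λ ())
%2≡1⇔isOdd 1 = mk⇔ (λ _ → refl) (λ _ → refl)
%2≡1⇔isOdd (suc (suc n)) rewrite not-involutive (isOdd n) = %2≡1⇔isOdd n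

false≢true : false ≢ true
false≢true ()

≢true⇒≡false : ∀ {b} → b ≢ true → b ≡ false
≢true⇒≡false = ¬-not

xor-true⇒≡not : ∀ x {y} → x xor y ≡ true → y ≡ not x
xor-true⇒≡not true  {false} _ = refl
xor-true⇒≡not false {true}  _ = refl

xor-via : ∀ x y z → x xor y ≡ (x xor z) xor (y xor z)
xor-via x y z = sym (trans (xor-interchange x z y z)
  (trans (cong ((x xor y) xor_) (xor-same z)) (xor-identityʳ (x xor y))))

xor-solveʳ : ∀ x {y z} → x xor y ≡ z → y ≡ x xor z
xor-solveʳ true  refl = sym (not-involutive _)
xor-solveʳ false refl = refl

xor-solveˡ : ∀ {x} y {z} → x xor y ≡ z → x ≡ y xor z
xor-solveˡ {x} y eq = xor-solveʳ y (trans (xor-comm y x) eq)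

xor-⇔ : ∀ {P Q : Set} x y → P ⇔ (x ≡ true) → Q ⇔ (y ≡ true) →
  ((P × ¬ Q) ⊎ (¬ P × Q)) ⇔ (x xor y ≡ true)
xor-⇔ true true P⇔ Q⇔ = mk⇔
  (λ { (inj₁ (_ , ¬q)) → ⊥-elim (¬q (Equivalence.from Q⇔ refl))
     ; (inj₂ (¬p , _)) → ⊥-elim (¬p (Equivalence.from P⇔ refl)) })
  (λ ())
xor-⇔ true false P⇔ Q⇔ = mk⇔ (λ _ → refl)
  (λ _ → inj₁ (Equivalence.from P⇔ refl , λ q → false≢true (Equivalence.to Q⇔ q)))
xor-⇔ false true P⇔ Q⇔ = mk⇔ (λ _ → refl)
  (λ _ → inj₂ ((λ p → false≢true (Equivalence.to P⇔ p)) , Equivalence.from Q⇔ refl))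
xor-⇔ false false P⇔ Q⇔ = mk⇔
  (λ { (inj₁ (p , _)) → ⊥-elim (false≢true (Equivalence.to P⇔ p))
     ; (inj₂ (_ , q)) → ⊥-elim (false≢true (Equivalence.to Q⇔ q)) })
  (λ ())

⌊⌋-true : ∀ {P : Set} (p? : Dec P) → P → ⌊ p? ⌋ ≡ true
⌊⌋-true (yes _) _ = refl
⌊⌋-true (no ¬p) p = ⊥-elim (¬p p)

⌊⌋-false : ∀ {P : Set} (p? : Dec P) → ¬ P → ⌊ p? ⌋ ≡ false
⌊⌋-false (yes p) ¬p = ⊥-elim (¬p p)
⌊⌋-false (no _)  _  = refl

⌊⌋-⇔ : ∀ {P Q : Set} → P ⇔ Q → (p? : Dec P) (q? : Dec Q) → ⌊ p? ⌋ ≡ ⌊ q? ⌋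
⌊⌋-⇔ P⇔Q (yes p) q? = sym (⌊⌋-true q? (Equivalence.to P⇔Q p))
⌊⌋-⇔ P⇔Q (no ¬p) q? = sym (⌊⌋-false q? (¬p ∘ Equivalence.from P⇔Q))

⌊⌋-xor : ∀ {P Q R : Set} → (Q → P) → (P × ¬ Q) ⇔ R →
  (p? : Dec P) (q? : Dec Q) (r? : Dec R) → ⌊ p? ⌋ xor ⌊ q? ⌋ ≡ ⌊ r? ⌋
⌊⌋-xor Q⇒P P∖Q⇔R (yes p) (yes q) r? = sym (⌊⌋-false r? λ r → proj₂ (Equivalence.from P∖Q⇔R r) q)
⌊⌋-xor Q⇒P P∖Q⇔R (yes p) (no ¬q) r? = sym (⌊⌋-true r? (Equivalence.to P∖Q⇔R (p , ¬q)))
⌊⌋-xor Q⇒P P∖Q⇔R (no ¬p) (yes q) r? = ⊥-elim (¬p (Q⇒P q))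
⌊⌋-xor Q⇒P P∖Q⇔R (no ¬p) (no ¬q) r? = sym (⌊⌋-false r? λ r → ¬p (proj₁ (Equivalence.from P∖Q⇔R r)))

private variable
  A B : Set

parity : (A → Bool) → List A → Bool
parity f []       = false
parity f (x ∷ xs) = f x xor parity f xs

isOdd-countᵇ : (f : A → Bool) (xs : List A) → isOdd (countᵇ f xs) ≡ parity f xs
isOdd-countᵇ f [] = refl
isOdd-countᵇ f (x ∷ xs) with f x
... | true  = cong not (isOdd-countᵇ f xs)
... | false = isOdd-countᵇ f xs

countᵇ%2≡1⇔parity : (f : A → Bool) (xs : List A) → (countᵇ f xs % 2 ≡ 1) ⇔ (parity f xs ≡ true)
countᵇ%2≡1⇔parity f xs =
  subst (λ b → (countᵇ f xs % 2 ≡ 1) ⇔ (b ≡ true)) (isOdd-countᵇ f xs) (%2≡1⇔isOdd (countᵇ f xs))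

parity-xor : (f g : A → Bool) (xs : List A) →
  parity (λ x → f x xor g x) xs ≡ parity f xs xor parity g xs
parity-xor f g [] = refl
parity-xor f g (x ∷ xs) =
  trans (cong ((f x xor g x) xor_) (parity-xor f g xs)) (xor-interchange (f x) (g x) _ _)

parity-cong : {f g : A → Bool} → (∀ x → f x ≡ g x) → (xs : List A) → parity f xs ≡ parity g xs
parity-cong f≗g [] = refl
parity-cong f≗g (x ∷ xs) = cong₂ _xor_ (f≗g x) (parity-cong f≗g xs)

parity-map : (f : B → Bool) (g : A → B) (xs : List A) → parity f (map g xs) ≡ parity (f ∘ g) xs
parity-map f g [] = refl
parity-map f g (x ∷ xs) = cong (f (g x) xor_) (parity-map f g xs)

parity-↭ : (f : A → Bool) {xs ys : List A} → xs ↭ ys → parity f xs ≡ parity f ys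
parity-↭ f ↭.refl = refl
parity-↭ f (↭.prep x p) = cong (f x xor_) (parity-↭ f p)
parity-↭ f (↭.swap x y p) =
  trans (cong (λ b → f x xor (f y xor b)) (parity-↭ f p)) (xor-left-comm (f x) (f y) _)
parity-↭ f (↭.trans p q) = trans (parity-↭ f p) (parity-↭ f q)

parity-false : {f : A → Bool} {xs : List A} → (∀ {x} → x ∈ xs → f x ≡ false) → parity f xs ≡ false
parity-false {xs = []} _ = refl
parity-false {xs = x ∷ xs} none rewrite none (here refl) = parity-false (none ∘ there)

parity-true⇒∃ : {f : A → Bool} (xs : List A) → parity f xs ≡ true → ∃[ x ] (x ∈ xs × f x ≡ true)
parity-true⇒∃ {f = f} (x ∷ xs) odd with f x in fx
... | true  = x , here refl , fx
... | false = let (y , y∈ , fy) = parity-true⇒∃ xs odd in y , there y∈ , fy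

parity-single : {f : A → Bool} {xs : List A} {x : A} → Unique xs → x ∈ xs → f x ≡ true →
  (∀ {y} → y ∈ xs → f y ≡ true → y ≡ x) → parity f xs ≡ true
parity-single {f = f} (z∉zs ∷ _) (here refl) fz only rewrite fz =
  cong not (parity-false others-false)
  where
  others-false : ∀ {y} → y ∈ _ → f y ≡ false
  others-false {y} y∈ with f y in fy
  ... | true  = ⊥-elim (All.lookup z∉zs y∈ (sym (only (there y∈) fy)))
  ... | false = refl
parity-single {f = f} {xs = z ∷ _} (z∉zs ∷ u) (there x∈) fx only with f z in fz
... | true  = ⊥-elim (All.lookup z∉zs x∈ (only (here refl) fz))
... | false = parity-single u x∈ fx (only ∘ there)

Unique-map⇒injectiveOn : {g : A → B} {xs : List A} → Unique (map g xs) →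
  ∀ {x y} → x ∈ xs → y ∈ xs → g x ≡ g y → x ≡ y
Unique-map⇒injectiveOn _ (here refl) (here refl) _ = refl
Unique-map⇒injectiveOn {g = g} (gz∉ ∷ _) (here refl) (there y∈) e =
  ⊥-elim (All.lookup gz∉ (∈-map⁺ g y∈) e)
Unique-map⇒injectiveOn {g = g} (gz∉ ∷ _) (there x∈) (here refl) e =
  ⊥-elim (All.lookup gz∉ (∈-map⁺ g x∈) (sym e))
Unique-map⇒injectiveOn (_ ∷ u) (there x∈) (there y∈) e = Unique-map⇒injectiveOn u x∈ y∈ e

injectiveOn⇒Unique-map : {g : A → B} {xs : List A} →
  (∀ {x y} → x ∈ xs → y ∈ xs → g x ≡ g y → x ≡ y) → Unique xs → Unique (map g xs)
injectiveOn⇒Unique-map inj [] = []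
injectiveOn⇒Unique-map inj (x∉ ∷ u) =
  All-map⁺ (All.tabulate λ y∈ gx≡gy → All.lookup x∉ y∈ (inj (here refl) (there y∈) gx≡gy))
  ∷ injectiveOn⇒Unique-map (λ x∈ y∈ → inj (there x∈) (there y∈)) u

module _ {R : A → A → Set} where

  Linked-successor : ∀ {x y} xs → Linked R (x ∷ xs ++ [ y ]) →
    ∀ {z} → z ∈ x ∷ xs → ∃[ w ] (w ∈ xs ++ [ y ] × R z w)
  Linked-successor [] (r ∷ [-]) (here refl) = _ , here refl , r
  Linked-successor (x ∷ xs) (r ∷ _) (here refl) = x , here refl , r
  Linked-successor (x ∷ xs) (_ ∷ l) (there z∈) =
    let (w , w∈ , r) = Linked-successor xs l z∈ in w , there w∈ , r

  Linked-map-shift : (f g : A → B) → (∀ {a b} → R a b → f a ≡ g b) →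
    ∀ {x y} xs → Linked R (x ∷ xs ++ [ y ]) → map f (x ∷ xs) ≡ map g (xs ++ [ y ])
  Linked-map-shift f g fg [] (r ∷ [-]) = cong [_] (fg r)
  Linked-map-shift f g fg (x ∷ xs) (r ∷ l) = cong₂ _∷_ (fg r) (Linked-map-shift f g fg xs l)

  module _ {S Q : A → Set} (step : ∀ {a b} → S a → S b → R a b → Q a → Q b) where

    Linked-fromHead : ∀ {y ys} → Linked R (y ∷ ys) → All S (y ∷ ys) → Q y → All Q (y ∷ ys)
    Linked-fromHead [-] _ q = q ∷ []
    Linked-fromHead (r ∷ l) (s ∷ ss) q = q ∷ Linked-fromHead l ss (step s (All.head ss) r q)

    Linked-toLast : ∀ {y} xs → Linked R (xs ++ [ y ]) → All S (xs ++ [ y ]) →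
      ∀ {z} → z ∈ xs ++ [ y ] → Q z → Q y
    Linked-toLast [] _ _ (here refl) q = q
    Linked-toLast (_ ∷ []) (r ∷ [-]) (s ∷ s′ ∷ []) (here refl) q = step s s′ r q
    Linked-toLast (_ ∷ []) _ _ (there (here refl)) q = q
    Linked-toLast (_ ∷ x ∷ xs) (r ∷ l) (s ∷ ss) (here refl) q =
      Linked-toLast (x ∷ xs) l ss (here refl) (step s (All.head ss) r q)
    Linked-toLast (_ ∷ x ∷ xs) (_ ∷ l) (_ ∷ ss) (there z∈) q = Linked-toLast (x ∷ xs) l ss z∈ q

    cycle-invariant : ∀ {x} xs → Linked R (x ∷ xs ++ [ x ]) → All S (x ∷ xs ++ [ x ]) →
      ∀ {z w} → z ∈ x ∷ xs → w ∈ x ∷ xs → Q z → Q w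
    cycle-invariant {x} xs l ss z∈ w∈ qz =
      All.lookup (Linked-fromHead l ss (Linked-toLast (x ∷ xs) l ss (∈-++⁺ˡ z∈) qz)) (∈-++⁺ˡ w∈)

HasParity : ℤ → Bool → Set
HasParity z false = EvenZ z
HasParity z true  = OddZ z

HasParity-+ : ∀ {x y} α β → HasParity x α → HasParity y β → HasParity (x + y) (α xor β)
HasParity-+ false false (k , refl) (m , refl) = k + m , lemma k m
  where
  lemma : ∀ k m → (k + k) + (m + m) ≡ (k + m) + (k + m)
  lemma = solve-∀
HasParity-+ false true (k , refl) (m , refl) = k + m , lemma k m
  where
  lemma : ∀ k m → (k + k) + (+ 1 + (m + m)) ≡ + 1 + ((k + m) + (k + m))
  lemma = solve-∀
HasParity-+ true false (k , refl) (m , refl) = k + m , lemma k m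
  where
  lemma : ∀ k m → (+ 1 + (k + k)) + (m + m) ≡ + 1 + ((k + m) + (k + m))
  lemma = solve-∀
HasParity-+ true true (k , refl) (m , refl) = k + m + + 1 , lemma k m
  where
  lemma : ∀ k m → (+ 1 + (k + k)) + (+ 1 + (m + m)) ≡ (k + m + + 1) + (k + m + + 1)
  lemma = solve-∀

n+n≢1 : ∀ n → n + n ≢ + 1
n+n≢1 (+ zero) ()
n+n≢1 (+ suc n) eq = ℕ.m+1+n≢0 n (ℕ.suc-injective (ℤ.+-injective eq))
n+n≢1 -[1+ n ] ()

EvenZ⇒¬OddZ : ∀ {z} → EvenZ z → ¬ OddZ z
EvenZ⇒¬OddZ (k , refl) (m , eq) =
  n+n≢1 (k - m) (trans (lemma₁ k m) (trans (cong (_- (m + m)) eq) (lemma₂ m)))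
  where
  lemma₁ : ∀ k m → (k - m) + (k - m) ≡ (k + k) - (m + m)
  lemma₁ = solve-∀
  lemma₂ : ∀ m → (+ 1 + (m + m)) - (m + m) ≡ + 1
  lemma₂ = solve-∀

HasParity-unique : ∀ {z} α β → HasParity z α → HasParity z β → α ≡ β
HasParity-unique false false _ _ = refl
HasParity-unique false true  p q = ⊥-elim (EvenZ⇒¬OddZ p q)
HasParity-unique true  false p q = ⊥-elim (EvenZ⇒¬OddZ q p)
HasParity-unique true  true  _ _ = refl

hasParity : ∀ z → ∃ (HasParity z)
hasParity (+ zero) = false , (+ 0 , refl)
hasParity (+ suc n) =
  let (β , p) = hasParity (+ n) in true xor β , HasParity-+ true β (+ 0 , refl) p
hasParity -[1+ zero ] = true , (-[1+ 0 ] , refl)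
hasParity -[1+ suc n ] =
  let (β , p) = hasParity -[1+ n ] in true xor β , HasParity-+ true β (-[1+ 0 ] , refl) p

double : ∀ i → + 2 * i ≡ i + i
double = solve-∀

halve : ∀ z → ∃[ i ] (z ≡ + 2 * i ⊎ z ≡ + 2 * i + + 1)
halve z with hasParity z
... | false , (i , z≡) = i , inj₁ (trans z≡ (sym (double i)))
... | true  , (i , z≡) = i , inj₂ (trans z≡ (lemma i))
  where
  lemma : ∀ i → + 1 + (i + i) ≡ + 2 * i + + 1
  lemma = solve-∀

halve-same : ∀ a a′ d → + 2 * a + d ≡ + 2 * a′ + d → a′ ≡ a
halve-same a a′ d eq =
  ℤ.*-cancelˡ-≡ (+ 2) a′ a (trans (lemma a′ d) (trans (cong (_- d) (sym eq)) (sym (lemma a d))))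
  where
  lemma : ∀ a d → + 2 * a ≡ (+ 2 * a + d) - d
  lemma = solve-∀

halve-opposite : ∀ a a′ d → + 2 * a + d ≡ + 2 * a′ + (- d) → a′ ≡ a + d
halve-opposite a a′ d eq =
  ℤ.*-cancelˡ-≡ (+ 2) a′ (a + d) (trans (lemma₁ a′ d) (trans (cong (_+ d) (sym eq)) (lemma₂ a d)))
  where
  lemma₁ : ∀ a′ d → + 2 * a′ ≡ (+ 2 * a′ + (- d)) + d
  lemma₁ = solve-∀
  lemma₂ : ∀ a d → (+ 2 * a + d) + d ≡ + 2 * (a + d)
  lemma₂ = solve-∀

<⇒+1≤ : ∀ {a b} → a < b → a + + 1 ≤ b
<⇒+1≤ {a} {b} a<b = subst (_≤ b) (ℤ.+-comm (+ 1) a) (ℤ.i<j⇒suc[i]≤j a<b)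

+1≤⇒< : ∀ {a b} → a + + 1 ≤ b → a < b
+1≤⇒< {a} {b} a+1≤b = ℤ.suc[i]≤j⇒i<j (subst (_≤ b) (ℤ.+-comm a (+ 1)) a+1≤b)

+1≤⇔< : ∀ a b → (a + + 1 ≤ b) ⇔ (a < b)
+1≤⇔< a b = mk⇔ +1≤⇒< <⇒+1≤

+-cancelʳ-≤ : ∀ k {a b} → a + k ≤ b + k → a ≤ b
+-cancelʳ-≤ k {a} {b} le = subst₂ _≤_ (lemma a k) (lemma b k) (ℤ.+-monoˡ-≤ (- k) le)
  where
  lemma : ∀ a k → (a + k) + (- k) ≡ a
  lemma = solve-∀

2a<2b+1⇔a≤b : ∀ a b → (+ 2 * a < + 2 * b + + 1) ⇔ (a ≤ b)
2a<2b+1⇔a≤b a b = mk⇔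
  (λ lt → ℤ.*-cancelˡ-≤-pos a b (+ 2) (+-cancelʳ-≤ (+ 1) (<⇒+1≤ lt)))
  (λ le → +1≤⇒< (ℤ.+-monoˡ-≤ (+ 1) (ℤ.*-monoˡ-≤-nonNeg (+ 2) le)))

2a<2b-1⇔a<b : ∀ a b → (+ 2 * a < + 2 * b + - + 1) ⇔ (a < b)
2a<2b-1⇔a<b a b = mk⇔
  (λ lt → +1≤⇒< (ℤ.*-cancelˡ-≤-pos (a + + 1) b (+ 2)
            (subst₂ _≤_ (sym (lemma₁ a)) (lemma₂ b) (ℤ.+-monoˡ-≤ (+ 1) (<⇒+1≤ lt)))))
  (λ lt → +1≤⇒< (+-cancelʳ-≤ (+ 1)
            (subst₂ _≤_ (lemma₁ a) (sym (lemma₂ b)) (ℤ.*-monoˡ-≤-nonNeg (+ 2) (<⇒+1≤ lt)))))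
  where
  lemma₁ : ∀ a → + 2 * (a + + 1) ≡ (+ 2 * a + + 1) + + 1
  lemma₁ = solve-∀
  lemma₂ : ∀ b → (+ 2 * b + - + 1) + + 1 ≡ + 2 * b
  lemma₂ = solve-∀

2a+1≡2b+1⇔a≡b : ∀ a b → (+ 2 * a + + 1 ≡ + 2 * b + + 1) ⇔ (a ≡ b)
2a+1≡2b+1⇔a≡b a b = mk⇔ (λ eq → sym (halve-same a b (+ 1) eq)) (cong (λ c → + 2 * c + + 1))

2a-1≡2b+1⇔a≡b+1 : ∀ a b → (+ 2 * a + - + 1 ≡ + 2 * b + + 1) ⇔ (a ≡ b + + 1)
2a-1≡2b+1⇔a≡b+1 a b = mk⇔ (λ eq → halve-opposite b a (+ 1) (sym eq)) λ { refl → lemma b }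
  where
  lemma : ∀ b → + 2 * (b + + 1) + - + 1 ≡ + 2 * b + + 1
  lemma = solve-∀

≤ᵇ-xor-<ᵇ : ∀ x u → ⌊ x ≤? u ⌋ xor ⌊ x <? u ⌋ ≡ ⌊ u ≟ x ⌋
≤ᵇ-xor-<ᵇ x u = ⌊⌋-xor ℤ.<⇒≤
  (mk⇔ (λ (x≤u , x≮u) → ℤ.≤-antisym (ℤ.≮⇒≥ x≮u) x≤u) λ { refl → ℤ.≤-refl , ℤ.<-irrefl refl })
  (x ≤? u) (x <? u) (u ≟ x)

≤ᵇ-xor-+1≤ᵇ : ∀ x u → ⌊ x ≤? u ⌋ xor ⌊ x + + 1 ≤? u ⌋ ≡ ⌊ u ≟ x ⌋
≤ᵇ-xor-+1≤ᵇ x u =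
  trans (cong (⌊ x ≤? u ⌋ xor_) (⌊⌋-⇔ (+1≤⇔< x u) (x + + 1 ≤? u) (x <? u))) (≤ᵇ-xor-<ᵇ x u)

<ᵇ-xor-+1<ᵇ : ∀ x u → ⌊ x <? u ⌋ xor ⌊ x + + 1 <? u ⌋ ≡ ⌊ u ≟ x + + 1 ⌋
<ᵇ-xor-+1<ᵇ x u =
  trans (cong (_xor ⌊ x + + 1 <? u ⌋) (⌊⌋-⇔ (⇔-sym (+1≤⇔< x u)) (x <? u) (x + + 1 ≤? u)))
        (≤ᵇ-xor-<ᵇ (x + + 1) u)

⌊2a+1≟2b+1⌋ : ∀ a b → ⌊ + 2 * a + + 1 ≟ + 2 * b + + 1 ⌋ ≡ ⌊ a ≟ b ⌋
⌊2a+1≟2b+1⌋ a b = ⌊⌋-⇔ (2a+1≡2b+1⇔a≡b a b) _ _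

⌊2a-1≟2b+1⌋ : ∀ a b → ⌊ + 2 * a + - + 1 ≟ + 2 * b + + 1 ⌋ ≡ ⌊ a ≟ b + + 1 ⌋
⌊2a-1≟2b+1⌋ a b = ⌊⌋-⇔ (2a-1≡2b+1⇔a≡b+1 a b) _ _

⌊2a<2b+1⌋ : ∀ a b → ⌊ + 2 * a <? + 2 * b + + 1 ⌋ ≡ ⌊ a ≤? b ⌋
⌊2a<2b+1⌋ a b = ⌊⌋-⇔ (2a<2b+1⇔a≤b a b) _ _

⌊2a<2b-1⌋ : ∀ a b → ⌊ + 2 * a <? + 2 * b + - + 1 ⌋ ≡ ⌊ a <? b ⌋
⌊2a<2b-1⌋ a b = ⌊⌋-⇔ (2a<2b-1⇔a<b a b) _ _

-- Points, circle centres and the two lattices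

⊕-assoc : (u v w : Point) → (u ⊕ v) ⊕ w ≡ u ⊕ (v ⊕ w)
⊕-assoc (a , b) (c , d) (e , f) = cong₂ _,_ (ℤ.+-assoc a c e) (ℤ.+-assoc b d f)

⊕-identityʳ : (u : Point) → u ⊕ (+ 0 , + 0) ≡ u
⊕-identityʳ (a , b) = cong₂ _,_ (ℤ.+-identityʳ a) (ℤ.+-identityʳ b)

⊕-regroup : ∀ v {a b c} → a ≡ b ⊕ c → v ⊕ a ≡ (v ⊕ b) ⊕ c
⊕-regroup v {b = b} {c} eq = trans (cong (v ⊕_) eq) (sym (⊕-assoc v b c))

_⊖_ : Point → Point → Point
(a , b) ⊖ (c , d) = (a - c , b - d)

⊖≡⇔≡⊕ : ∀ c p r → (c ⊖ p ≡ r) ⇔ (c ≡ p ⊕ r)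
⊖≡⇔≡⊕ (a , b) (x , y) r = mk⇔
  (λ { refl → cong₂ _,_ (lemma₁ a x) (lemma₁ b y) })
  (λ { refl → cong₂ _,_ (lemma₂ x (proj₁ r)) (lemma₂ y (proj₂ r)) })
  where
  lemma₁ : ∀ a x → a ≡ x + (a - x)
  lemma₁ = solve-∀
  lemma₂ : ∀ x u → (x + u) - x ≡ u
  lemma₂ = solve-∀

latticeParity : Lattice → Bool
latticeParity L₁ = false
latticeParity L₂ = true

InLattice⇒HasParity : ∀ ℓ {a b} → InLattice ℓ (a , b) →
  HasParity a (latticeParity ℓ) × HasParity b (latticeParity ℓ)
InLattice⇒HasParity L₁ p = p
InLattice⇒HasParity L₂ p = p

HasParity⇒InLattice : ∀ ℓ {a b} → HasParity a (latticeParity ℓ) → HasParity b (latticeParity ℓ) →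
  InLattice ℓ (a , b)
HasParity⇒InLattice L₁ p q = p , q
HasParity⇒InLattice L₂ p q = p , q

InLattice⇒IsCentre : ∀ ℓ {c} → InLattice ℓ c → IsCentre c
InLattice⇒IsCentre L₁ = inj₁
InLattice⇒IsCentre L₂ = inj₂

IsCentre⇒HasParity : ∀ {a b} → IsCentre (a , b) → ∃[ β ] (HasParity a β × HasParity b β)
IsCentre⇒HasParity (inj₁ p) = false , p
IsCentre⇒HasParity (inj₂ p) = true , p

HasParity⇒IsCentre : ∀ {a b} β → HasParity a β → HasParity b β → IsCentre (a , b)
HasParity⇒IsCentre false p q = inj₁ (p , q)
HasParity⇒IsCentre true  p q = inj₂ (p , q)

IsCentre-⊕-odd : ∀ {c dx dy} → IsCentre c → OddZ dx → OddZ dy → IsCentre (c ⊕ (dx , dy))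
IsCentre-⊕-odd c∈ px py with IsCentre⇒HasParity c∈
... | β , pa , pb = HasParity⇒IsCentre (β xor true) (HasParity-+ β true pa px) (HasParity-+ β true pb py)

¬IsCentre-⊕-mixed : ∀ {c dx dy} α → IsCentre c → HasParity dx α → HasParity dy (not α) →
  ¬ IsCentre (c ⊕ (dx , dy))
¬IsCentre-⊕-mixed α c∈ px py c⊕d∈ with IsCentre⇒HasParity c∈ | IsCentre⇒HasParity c⊕d∈
... | β , pa , pb | γ , qa , qb =
  not-¬ refl (trans (HasParity-unique _ _ (HasParity-+ β α pa px) qa)
             (trans (HasParity-unique _ _ qb (HasParity-+ β (not α) pb py)) (sym (not-distribʳ-xor β α))))

InLattice-⊕-even : ∀ ℓ {c dx dy} → InLattice ℓ c → EvenZ dx → EvenZ dy → InLattice ℓ (c ⊕ (dx , dy))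
InLattice-⊕-even ℓ c∈ px py =
  HasParity⇒InLattice ℓ (shift (proj₁ (InLattice⇒HasParity ℓ c∈)) px)
                        (shift (proj₂ (InLattice⇒HasParity ℓ c∈)) py)
  where
  shift : ∀ {a d} → HasParity a (latticeParity ℓ) → EvenZ d → HasParity (a + d) (latticeParity ℓ)
  shift pa pd = subst (HasParity _) (xor-identityʳ _) (HasParity-+ _ false pa pd)

InLattice-⊕-odd : ∀ ℓ {c dx dy} → InLattice ℓ c → OddZ dx → OddZ dy → ¬ InLattice ℓ (c ⊕ (dx , dy))
InLattice-⊕-odd ℓ c∈ px _ c⊕d∈ =
  not-¬ refl (HasParity-unique _ _ (proj₁ (InLattice⇒HasParity ℓ c⊕d∈))
    (subst (HasParity _) (xor-comm _ true) (HasParity-+ _ true (proj₁ (InLattice⇒HasParity ℓ c∈)) px)))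

¬InLattice-⊕-odd : ∀ ℓ {c dx dy} → IsCentre c → ¬ InLattice ℓ c → OddZ dx → OddZ dy →
  InLattice ℓ (c ⊕ (dx , dy))
¬InLattice-⊕-odd ℓ c∈ c∉ℓ px py with IsCentre⇒HasParity c∈
... | β , pa , pb = HasParity⇒InLattice ℓ (shift pa px) (shift pb py)
  where
  not-β≡ℓ : not β ≡ latticeParity ℓ
  not-β≡ℓ = sym (¬-not λ ℓ≡β → c∉ℓ (HasParity⇒InLattice ℓ (subst (HasParity _) (sym ℓ≡β) pa)
                                                          (subst (HasParity _) (sym ℓ≡β) pb)))
  shift : ∀ {a d} → HasParity a β → OddZ d → HasParity (a + d) (latticeParity ℓ)
  shift pa pd = subst (HasParity _) (trans (xor-comm β true) not-β≡ℓ) (HasParity-+ β true pa pd)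

-- Intercardinal points, quarters and joins of links

offset-odd : ∀ i → OddZ (proj₁ (offset i)) × OddZ (proj₂ (offset i))
offset-odd NE = (+ 0 , refl) , (+ 0 , refl)
offset-odd NW = (-[1+ 0 ] , refl) , (+ 0 , refl)
offset-odd SW = (-[1+ 0 ] , refl) , (-[1+ 0 ] , refl)
offset-odd SE = (+ 0 , refl) , (-[1+ 0 ] , refl)

opposite : ICP → ICP
opposite NE = SW
opposite NW = SE
opposite SW = NE
opposite SE = NW

offset-opposite : ∀ i → offset (opposite i) ≡ (- proj₁ (offset i) , - proj₂ (offset i))
offset-opposite NE = refl
offset-opposite NW = refl
offset-opposite SW = refl
offset-opposite SE = refl

quadrant : Point → ICP
quadrant (+ _      , + _)      = NE
quadrant (-[1+ _ ] , + _)      = NW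
quadrant (-[1+ _ ] , -[1+ _ ]) = SW
quadrant (+ _      , -[1+ _ ]) = SE

quadrant∘offset : ∀ i → quadrant (offset i) ≡ i
quadrant∘offset NE = refl
quadrant∘offset NW = refl
quadrant∘offset SW = refl
quadrant∘offset SE = refl

offset-injective : ∀ {i j} → offset i ≡ offset j → i ≡ j
offset-injective {i} {j} eq = trans (sym (quadrant∘offset i)) (trans (cong quadrant eq) (quadrant∘offset j))

position-injective : ∀ c c′ i → position c i ≡ position c′ i → c′ ≡ c
position-injective (a , b) (a′ , b′) i eq =
  cong₂ _,_ (halve-same a a′ _ (cong proj₁ eq)) (halve-same b b′ _ (cong proj₂ eq))

position-opposite : ∀ c c′ i → position c i ≡ position c′ (opposite i) → c′ ≡ c ⊕ offset i
position-opposite (a , b) (a′ , b′) i eq =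
  cong₂ _,_ (halve-opposite a a′ _ (cong proj₁ eq′)) (halve-opposite b b′ _ (cong proj₂ eq′))
  where
  eq′ = trans eq (cong ((+ 2 * a′ , + 2 * b′) ⊕_) (offset-opposite i))

turn : Bool → ICP → ICP
turn true  NE = NW
turn true  NW = SW
turn true  SW = SE
turn true  SE = NE
turn false NE = SE
turn false SE = SW
turn false SW = NW
turn false NW = NE

tangentAt≡offset∘turn : ∀ b i → tangentAt b i ≡ offset (turn b i)
tangentAt≡offset∘turn true  NE = refl
tangentAt≡offset∘turn true  NW = refl
tangentAt≡offset∘turn true  SW = refl
tangentAt≡offset∘turn true  SE = refl
tangentAt≡offset∘turn false NE = refl
tangentAt≡offset∘turn false NW = refl
tangentAt≡offset∘turn false SW = refl
tangentAt≡offset∘turn false SE = refl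

turn-inverse : ∀ b i → turn (not b) (turn b i) ≡ i
turn-inverse true  NE = refl
turn-inverse true  NW = refl
turn-inverse true  SW = refl
turn-inverse true  SE = refl
turn-inverse false NE = refl
turn-inverse false NW = refl
turn-inverse false SW = refl
turn-inverse false SE = refl

turn-twice : ∀ b i → turn b (turn b i) ≡ opposite i
turn-twice true  NE = refl
turn-twice true  NW = refl
turn-twice true  SW = refl
turn-twice true  SE = refl
turn-twice false NE = refl
turn-twice false NW = refl
turn-twice false SW = refl
turn-twice false SE = refl

turn-injective : ∀ b {i j} → turn b i ≡ turn b j → i ≡ j
turn-injective b {i} {j} eq =
  trans (sym (turn-inverse b i)) (trans (cong (turn (not b)) eq) (turn-inverse b j))

turn-reversed : ∀ b {i j} → turn b i ≡ turn (not b) j → j ≡ opposite i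
turn-reversed b {i} {j} eq = begin
  j                                    ≡⟨ turn-inverse (not b) j ⟨
  turn (not (not b)) (turn (not b) j)  ≡⟨ cong (λ b′ → turn b′ (turn (not b) j)) (not-involutive b) ⟩
  turn b (turn (not b) j)              ≡⟨ cong (turn b) eq ⟨
  turn b (turn b i)                    ≡⟨ turn-twice b i ⟩
  opposite i                           ∎
  where open ≡-Reasoning

tangentAt-cases : ∀ b i b′ j → tangentAt b i ≡ tangentAt b′ j →
  (b′ ≡ b × j ≡ i) ⊎ (b′ ≡ not b × j ≡ opposite i)
tangentAt-cases b i b′ j eq = cases b b′ (offset-injective (begin
  offset (turn b i)   ≡⟨ tangentAt≡offset∘turn b i ⟨
  tangentAt b i       ≡⟨ eq ⟩
  tangentAt b′ j      ≡⟨ tangentAt≡offset∘turn b′ j ⟩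
  offset (turn b′ j)  ∎))
  where
  open ≡-Reasoning
  cases : ∀ b b′ → turn b i ≡ turn b′ j → (b′ ≡ b × j ≡ i) ⊎ (b′ ≡ not b × j ≡ opposite i)
  cases true  true  e = inj₁ (refl , sym (turn-injective true e))
  cases false false e = inj₁ (refl , sym (turn-injective false e))
  cases true  false e = inj₂ (refl , turn-reversed true e)
  cases false true  e = inj₂ (refl , turn-reversed false e)

tangentAt-reversed : ∀ i → tangentAt true i ≢ tangentAt false i
tangentAt-reversed NE ()
tangentAt-reversed NW ()
tangentAt-reversed SW ()
tangentAt-reversed SE ()

startQuad : Bool → ICP → Quad
startQuad true  NE = qN
startQuad true  NW = qW
startQuad true  SW = qS
startQuad true  SE = qE
startQuad false NW = qN
startQuad false SW = qW
startQuad false SE = qS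
startQuad false NE = qE

startQuad∘ccwStart : ∀ Q → startQuad true (ccwStart Q) ≡ Q
startQuad∘ccwStart qN = refl
startQuad∘ccwStart qE = refl
startQuad∘ccwStart qS = refl
startQuad∘ccwStart qW = refl

startQuad∘ccwEnd : ∀ Q → startQuad false (ccwEnd Q) ≡ Q
startQuad∘ccwEnd qN = refl
startQuad∘ccwEnd qE = refl
startQuad∘ccwEnd qS = refl
startQuad∘ccwEnd qW = refl

startQuad∘startICP : ∀ l → startQuad (ccw l) (startICP l) ≡ quad l
startQuad∘startICP (olink _ Q true)  = startQuad∘ccwStart Q
startQuad∘startICP (olink _ Q false) = startQuad∘ccwEnd Q

ccwStart-injective : ∀ {Q Q′} → ccwStart Q ≡ ccwStart Q′ → Q ≡ Q′
ccwStart-injective {Q} {Q′} eq =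
  trans (sym (startQuad∘ccwStart Q)) (trans (cong (startQuad true) eq) (startQuad∘ccwStart Q′))

_≟Q_ : DecidableEquality Quad
Q ≟Q Q′ = map′ (ccwStart-injective ∘ offset-injective) (cong (offset ∘ ccwStart))
               (≡-dec ℤ._≟_ ℤ._≟_ (offset (ccwStart Q)) (offset (ccwStart Q′)))

oppositeQuad : Quad → Quad
oppositeQuad qN = qS
oppositeQuad qE = qW
oppositeQuad qS = qN
oppositeQuad qW = qE

outward : Quad → Point
outward qN = (+ 0 , + 1)
outward qE = (+ 1 , + 0)
outward qS = (+ 0 , - + 1)
outward qW = (- + 1 , + 0)

¬IsCentre-⊕-outward : ∀ {c} Q → IsCentre c → ¬ IsCentre (c ⊕ outward Q)
¬IsCentre-⊕-outward qN c∈ = ¬IsCentre-⊕-mixed false c∈ (+ 0 , refl) (+ 0 , refl)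
¬IsCentre-⊕-outward qE c∈ = ¬IsCentre-⊕-mixed true c∈ (+ 0 , refl) (+ 0 , refl)
¬IsCentre-⊕-outward qS c∈ = ¬IsCentre-⊕-mixed false c∈ (+ 0 , refl) (-[1+ 0 ] , refl)
¬IsCentre-⊕-outward qW c∈ = ¬IsCentre-⊕-mixed true c∈ (-[1+ 0 ] , refl) (+ 0 , refl)

⊕-outward-back : ∀ c Q → (c ⊕ outward Q) ⊕ outward (oppositeQuad Q) ≡ c
⊕-outward-back c qN = trans (⊕-assoc c _ _) (⊕-identityʳ c)
⊕-outward-back c qE = trans (⊕-assoc c _ _) (⊕-identityʳ c)
⊕-outward-back c qS = trans (⊕-assoc c _ _) (⊕-identityʳ c)
⊕-outward-back c qW = trans (⊕-assoc c _ _) (⊕-identityʳ c)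

horizQuad vertQuad : ICP → Quad
horizQuad NE = qE
horizQuad SE = qE
horizQuad NW = qW
horizQuad SW = qW
vertQuad NE = qN
vertQuad NW = qN
vertQuad SE = qS
vertQuad SW = qS

diagonal-⊕-outward : ∀ c i → (c ⊕ offset i) ⊕ outward (vertQuad (opposite i)) ≡ c ⊕ outward (horizQuad i)
diagonal-⊕-outward c NE = ⊕-assoc c _ _
diagonal-⊕-outward c NW = ⊕-assoc c _ _
diagonal-⊕-outward c SW = ⊕-assoc c _ _
diagonal-⊕-outward c SE = ⊕-assoc c _ _

horizQuad-ends : ∀ i → i ≡ ccwStart (horizQuad i) ⊎ i ≡ ccwEnd (horizQuad i)
horizQuad-ends NE = inj₂ refl
horizQuad-ends SE = inj₁ refl
horizQuad-ends NW = inj₁ refl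
horizQuad-ends SW = inj₂ refl

vertQuad-ends : ∀ i → i ≡ ccwStart (vertQuad i) ⊎ i ≡ ccwEnd (vertQuad i)
vertQuad-ends NE = inj₁ refl
vertQuad-ends NW = inj₂ refl
vertQuad-ends SE = inj₂ refl
vertQuad-ends SW = inj₁ refl

horizQuad≢vertQuad : ∀ i → horizQuad i ≢ vertQuad i
horizQuad≢vertQuad NE ()
horizQuad≢vertQuad NW ()
horizQuad≢vertQuad SW ()
horizQuad≢vertQuad SE ()

horizQuad≢vertQuad∘opposite : ∀ i → horizQuad i ≢ vertQuad (opposite i)
horizQuad≢vertQuad∘opposite NE ()
horizQuad≢vertQuad∘opposite NW ()
horizQuad≢vertQuad∘opposite SW ()
horizQuad≢vertQuad∘opposite SE ()

oppositeQuad∘horizQuad : ∀ i → oppositeQuad (horizQuad i) ≡ horizQuad (opposite i)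
oppositeQuad∘horizQuad NE = refl
oppositeQuad∘horizQuad NW = refl
oppositeQuad∘horizQuad SW = refl
oppositeQuad∘horizQuad SE = refl

oppositeQuad∘vertQuad : ∀ i → oppositeQuad (vertQuad i) ≡ vertQuad (opposite i)
oppositeQuad∘vertQuad NE = refl
oppositeQuad∘vertQuad NW = refl
oppositeQuad∘vertQuad SW = refl
oppositeQuad∘vertQuad SE = refl

quad-at-endICP : ∀ l → quad l ≡ horizQuad (endICP l) ⊎ quad l ≡ vertQuad (endICP l)
quad-at-endICP (olink _ qN true)  = inj₂ refl
quad-at-endICP (olink _ qN false) = inj₂ refl
quad-at-endICP (olink _ qS true)  = inj₂ refl
quad-at-endICP (olink _ qS false) = inj₂ refl
quad-at-endICP (olink _ qE true)  = inj₁ refl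
quad-at-endICP (olink _ qE false) = inj₁ refl
quad-at-endICP (olink _ qW true)  = inj₁ refl
quad-at-endICP (olink _ qW false) = inj₁ refl

other-quarter-at-end : ∀ l → ∃[ Q ] ((endICP l ≡ ccwStart Q ⊎ endICP l ≡ ccwEnd Q) × quad l ≢ Q)
other-quarter-at-end l with quad-at-endICP l
... | inj₁ horiz = vertQuad (endICP l) , vertQuad-ends _ , λ e → horizQuad≢vertQuad _ (trans (sym horiz) e)
... | inj₂ vert  = horizQuad (endICP l) , horizQuad-ends _ , λ e → horizQuad≢vertQuad _ (trans (sym e) vert)

start-or-end : ∀ l {j} → j ≡ ccwStart (quad l) ⊎ j ≡ ccwEnd (quad l) → startICP l ≡ j ⊎ endICP l ≡ j
start-or-end (olink _ _ true)  (inj₁ refl) = inj₁ refl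
start-or-end (olink _ _ true)  (inj₂ refl) = inj₂ refl
start-or-end (olink _ _ false) (inj₁ refl) = inj₂ refl
start-or-end (olink _ _ false) (inj₂ refl) = inj₁ refl

-- The link continuing l smoothly on the neighbouring circle through the end point of l.
crossing : OLink → OLink
crossing l = olink (centre l ⊕ offset (endICP l)) (oppositeQuad (quad l)) (not (ccw l))

startQuad-crossing : ∀ l → startQuad (not (ccw l)) (opposite (endICP l)) ≡ oppositeQuad (quad l)
startQuad-crossing (olink _ qN true)  = refl
startQuad-crossing (olink _ qN false) = refl
startQuad-crossing (olink _ qS true)  = refl
startQuad-crossing (olink _ qS false) = refl
startQuad-crossing (olink _ qE true)  = refl
startQuad-crossing (olink _ qE false) = refl
startQuad-crossing (olink _ qW true)  = refl
startQuad-crossing (olink _ qW false) = refl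

startICP-crossing : ∀ l → startICP (crossing l) ≡ opposite (endICP l)
startICP-crossing (olink _ qN true)  = refl
startICP-crossing (olink _ qN false) = refl
startICP-crossing (olink _ qS true)  = refl
startICP-crossing (olink _ qS false) = refl
startICP-crossing (olink _ qE true)  = refl
startICP-crossing (olink _ qE false) = refl
startICP-crossing (olink _ qW true)  = refl
startICP-crossing (olink _ qW false) = refl

olink-≡ : ∀ {l m} → centre l ≡ centre m → quad l ≡ quad m → ccw l ≡ ccw m → l ≡ m
olink-≡ {olink _ _ _} {olink _ _ _} refl refl refl = refl

Joins-cases : ∀ {a b} → Joins a b → centre b ≡ centre a ⊎ b ≡ crossing a
Joins-cases {a} {b} (pt , tan) with tangentAt-cases (ccw a) (endICP a) (ccw b) (startICP b) tan
... | inj₁ (_ , j≡i) =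
  inj₁ (position-injective (centre a) (centre b) (endICP a) (trans pt (cong (position (centre b)) j≡i)))
... | inj₂ (ccw≡ , j≡opp) = inj₂ (olink-≡ centre≡ quad≡ ccw≡)
  where
  centre≡ : centre b ≡ centre a ⊕ offset (endICP a)
  centre≡ = position-opposite (centre a) (centre b) (endICP a) (trans pt (cong (position (centre b)) j≡opp))
  quad≡ : quad b ≡ oppositeQuad (quad a)
  quad≡ = trans (sym (startQuad∘startICP b)) (trans (cong₂ startQuad ccw≡ j≡opp) (startQuad-crossing a))

-- Ray crossings of a single link

-- The conjuncts are ordered as in crossesRayᵇ, so that the identities
-- below reduce by case analysis on the link.
isQuarterᵇ : Point → Quad → OLink → Bool
isQuarterᵇ (x , y) Q l = ⌊ quad l ≟Q Q ⌋ ∧ (⌊ proj₂ (centre l) ≟ y ⌋ ∧ ⌊ proj₁ (centre l) ≟ x ⌋)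

isQuarterᵇ-sound : ∀ c Q l → isQuarterᵇ c Q l ≡ true → centre l ≡ c × quad l ≡ Q
isQuarterᵇ-sound (x , y) Q (olink (u , v) q _) eq with q ≟Q Q | v ≟ y | u ≟ x
isQuarterᵇ-sound _ _ _ _  | yes refl | yes refl | yes refl = refl , refl
isQuarterᵇ-sound _ _ _ () | no _     | _        | _
isQuarterᵇ-sound _ _ _ () | yes _    | no _     | _
isQuarterᵇ-sound _ _ _ () | yes _    | yes _    | no _

isQuarterᵇ-complete : ∀ l → isQuarterᵇ (centre l) (quad l) l ≡ true
isQuarterᵇ-complete (olink (u , v) q _)
  rewrite ⌊⌋-true (q ≟Q q) refl | ⌊⌋-true (v ≟ v) refl | ⌊⌋-true (u ≟ u) refl = refl

-- Does the intercardinal point, in doubled coordinates, lie on the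
-- rightward ray from q + (0 , 1/2)?
onMidRayᵇ : Point → Point → Bool
onMidRayᵇ (x , y) (X , Y) = ⌊ Y ≟ + 2 * y + + 1 ⌋ ∧ ⌊ + 2 * x <? X ⌋

crossesRay-east : ∀ q l → crossesRayᵇ q l xor crossesRayᵇ (q ⊕ (+ 1 , + 0)) l
  ≡ isQuarterᵇ q qE l xor isQuarterᵇ (q ⊕ (+ 1 , + 0)) qW l
crossesRay-east (x , y) (olink (u , v) qN _) = refl
crossesRay-east (x , y) (olink (u , v) qS _) = refl
crossesRay-east (x , y) (olink (u , v) qE _) rewrite ℤ.+-identityʳ y =
  trans (sym (∧-distribˡ-xor ⌊ v ≟ y ⌋ _ _))
        (trans (cong (⌊ v ≟ y ⌋ ∧_) (≤ᵇ-xor-+1≤ᵇ x u)) (sym (xor-identityʳ _)))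
crossesRay-east (x , y) (olink (u , v) qW _) rewrite ℤ.+-identityʳ y =
  trans (sym (∧-distribˡ-xor ⌊ v ≟ y ⌋ _ _)) (cong (⌊ v ≟ y ⌋ ∧_) (<ᵇ-xor-+1<ᵇ x u))

crossesRay-north-quarter : ∀ x y u v Q o → let l = olink (u , v) Q o in
  crossesRayᵇ (x , y) l xor crossesRayᵇ ((x , y) ⊕ (+ 0 , + 1)) l
  ≡ (isQuarterᵇ (x , y) qN l xor isQuarterᵇ ((x , y) ⊕ (+ 0 , + 1)) qS l)
    xor (onMidRayᵇ (x , y) (position (u , v) (ccwStart Q)) xor onMidRayᵇ (x , y) (position (u , v) (ccwEnd Q)))
crossesRay-north-quarter x y u v qE _
  rewrite ℤ.+-identityʳ x | ⌊2a+1≟2b+1⌋ v y | ⌊2a-1≟2b+1⌋ v y | ⌊2a<2b+1⌋ x u =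
  xor-comm (⌊ v ≟ y ⌋ ∧ ⌊ x ≤? u ⌋) _
crossesRay-north-quarter x y u v qW _
  rewrite ℤ.+-identityʳ x | ⌊2a+1≟2b+1⌋ v y | ⌊2a-1≟2b+1⌋ v y | ⌊2a<2b-1⌋ x u = refl
crossesRay-north-quarter x y u v qN _
  rewrite ⌊2a+1≟2b+1⌋ v y | ⌊2a<2b+1⌋ x u | ⌊2a<2b-1⌋ x u with ⌊ v ≟ y ⌋
... | false = refl
... | true  = sym (trans (cong₂ _xor_ (xor-identityʳ ⌊ u ≟ x ⌋) (≤ᵇ-xor-<ᵇ x u)) (xor-same ⌊ u ≟ x ⌋))
crossesRay-north-quarter x y u v qS _
  rewrite ℤ.+-identityʳ x | ⌊2a-1≟2b+1⌋ v y | ⌊2a<2b+1⌋ x u | ⌊2a<2b-1⌋ x u with ⌊ v ≟ y + + 1 ⌋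
... | false = refl
... | true  =
  sym (trans (cong (⌊ u ≟ x ⌋ xor_) (trans (xor-comm ⌊ x <? u ⌋ _) (≤ᵇ-xor-<ᵇ x u))) (xor-same ⌊ u ≟ x ⌋))

crossesRay-north : ∀ q l → crossesRayᵇ q l xor crossesRayᵇ (q ⊕ (+ 0 , + 1)) l
  ≡ (isQuarterᵇ q qN l xor isQuarterᵇ (q ⊕ (+ 0 , + 1)) qS l)
    xor (onMidRayᵇ q (startPt l) xor onMidRayᵇ q (endPt l))
crossesRay-north (x , y) (olink (u , v) Q true)  = crossesRay-north-quarter x y u v Q true
crossesRay-north (x , y) (olink (u , v) Q false) =
  trans (crossesRay-north-quarter x y u v Q false)
        (cong ((isQuarterᵇ (x , y) qN l xor isQuarterᵇ ((x , y) ⊕ (+ 0 , + 1)) qS l) xor_)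
              (xor-comm (onMidRayᵇ (x , y) (position (u , v) (ccwStart Q))) _))
  where l = olink (u , v) Q false

-- Unit edges of the grid

lowCell highCell : UnitEdge → Point
lowCell (hor x y) = (x , y - + 1)
lowCell (ver x y) = (x - + 1 , y)
highCell (hor x y) = (x , y)
highCell (ver x y) = (x , y)

lowQuad : UnitEdge → Quad
lowQuad (hor _ _) = qN
lowQuad (ver _ _) = qE

highCell≡lowCell⊕outward : ∀ e → highCell e ≡ lowCell e ⊕ outward (lowQuad e)
highCell≡lowCell⊕outward (hor x y) = cong₂ _,_ (sym (ℤ.+-identityʳ x)) (lemma y)
  where
  lemma : ∀ y → y ≡ (y - + 1) + + 1
  lemma = solve-∀
highCell≡lowCell⊕outward (ver x y) = cong₂ _,_ (lemma x) (sym (ℤ.+-identityʳ y))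
  where
  lemma : ∀ x → x ≡ (x - + 1) + + 1
  lemma = solve-∀

OnBoundary⇔ : ∀ P e → OnBoundary P e ⇔ ((P (highCell e) × ¬ P (lowCell e)) ⊎ (¬ P (highCell e) × P (lowCell e)))
OnBoundary⇔ P (hor x y) = mk⇔ id id
OnBoundary⇔ P (ver x y) = mk⇔ id id

edgeBetween : Point → Quad → UnitEdge
edgeBetween (x , y) qN = hor x (y + + 1)
edgeBetween (x , y) qS = hor x y
edgeBetween (x , y) qE = ver (x + + 1) y
edgeBetween (x , y) qW = ver x y

edgeBetween≡⇔ : ∀ r Q e → (edgeBetween r Q ≡ e) ⇔
  ((r ≡ lowCell e × Q ≡ lowQuad e) ⊎ (r ≡ highCell e × Q ≡ oppositeQuad (lowQuad e)))
edgeBetween≡⇔ (a , b) qN (hor x y) = mk⇔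
  (λ { refl → inj₁ (cong (a ,_) (lemma₁ b) , refl) })
  (λ { (inj₁ (refl , refl)) → cong (hor x) (lemma₂ y) ; (inj₂ (_ , ())) })
  where
  lemma₁ : ∀ b → b ≡ (b + + 1) - + 1
  lemma₁ = solve-∀
  lemma₂ : ∀ y → (y - + 1) + + 1 ≡ y
  lemma₂ = solve-∀
edgeBetween≡⇔ (a , b) qS (hor x y) = mk⇔
  (λ { refl → inj₂ (refl , refl) })
  (λ { (inj₁ (_ , ())) ; (inj₂ (refl , refl)) → refl })
edgeBetween≡⇔ (a , b) qE (ver x y) = mk⇔
  (λ { refl → inj₁ (cong (_, b) (lemma₁ a) , refl) })
  (λ { (inj₁ (refl , refl)) → cong (λ x → ver x y) (lemma₂ x) ; (inj₂ (_ , ())) })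
  where
  lemma₁ : ∀ a → a ≡ (a + + 1) - + 1
  lemma₁ = solve-∀
  lemma₂ : ∀ x → (x - + 1) + + 1 ≡ x
  lemma₂ = solve-∀
edgeBetween≡⇔ (a , b) qW (ver x y) = mk⇔
  (λ { refl → inj₂ (refl , refl) })
  (λ { (inj₁ (_ , ())) ; (inj₂ (refl , refl)) → refl })
edgeBetween≡⇔ (a , b) qN (ver x y) = mk⇔ (λ ()) (λ { (inj₁ (_ , ())) ; (inj₂ (_ , ())) })
edgeBetween≡⇔ (a , b) qS (ver x y) = mk⇔ (λ ()) (λ { (inj₁ (_ , ())) ; (inj₂ (_ , ())) })
edgeBetween≡⇔ (a , b) qE (hor x y) = mk⇔ (λ ()) (λ { (inj₁ (_ , ())) ; (inj₂ (_ , ())) })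
edgeBetween≡⇔ (a , b) qW (hor x y) = mk⇔ (λ ()) (λ { (inj₁ (_ , ())) ; (inj₂ (_ , ())) })

module TangleProperties (T : Tangle) where
  open Tangle T

  centre-IsCentre : ∀ {l} → l ∈ links T → IsCentre (centre l)
  centre-IsCentre = All.lookup centresOK

  rotation : links T ↭ rest ++ [ first ]
  rotation = ∷↭∷ʳ first rest

  startPt-injective : ∀ {l m} → l ∈ links T → m ∈ links T → startPt l ≡ startPt m → l ≡ m
  startPt-injective = Unique-map⇒injectiveOn simple

  endPts≡rotated-startPts : map endPt (links T) ≡ map startPt (rest ++ [ first ])
  endPts≡rotated-startPts = Linked-map-shift endPt startPt proj₁ rest closed

  endPt-injective : ∀ {l m} → l ∈ links T → m ∈ links T → endPt l ≡ endPt m → l ≡ m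
  endPt-injective = Unique-map⇒injectiveOn (subst Unique (sym endPts≡rotated-startPts)
    (↭ₛ.Unique-resp-↭ (setoid Point) (↭⇒↭ₛ (↭.map⁺ startPt rotation)) simple))

  successor : ∀ {l} → l ∈ links T → ∃[ m ] (m ∈ links T × Joins l m)
  successor l∈ =
    let (m , m∈ , j) = Linked-successor rest closed l∈ in m , ∈-resp-↭ (↭-sym rotation) m∈ , j

  along-tangle : (P : OLink → Set) → (∀ {a b} → a ∈ links T → b ∈ links T → Joins a b → P a → P b) →
    ∀ {l m} → l ∈ links T → m ∈ links T → P l → P m
  along-tangle P step = cycle-invariant step rest closed (All.tabulate closed⊆links)
    where
    closed⊆links : ∀ {z} → z ∈ first ∷ rest ++ [ first ] → z ∈ links T
    closed⊆links (here refl) = here refl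
    closed⊆links (there z∈)  = ∈-resp-↭ (↭-sym rotation) z∈

  insideᵇ : Point → Bool
  insideᵇ q = parity (crossesRayᵇ q) (links T)

  DiskInside⇔insideᵇ : ∀ q → DiskInside T q ⇔ (insideᵇ q ≡ true)
  DiskInside⇔insideᵇ q = countᵇ%2≡1⇔parity (crossesRayᵇ q) (links T)

  linkedᵇ : Point → Quad → Bool
  linkedᵇ c Q = parity (isQuarterᵇ c Q) (links T)

  reversal-absent : ∀ {c Q} → olink c Q true ∈ links T → ¬ olink c Q false ∈ links T
  reversal-absent {c} {Q} l∈ l̄∈ with successor l∈
  ... | m , m∈ , (pt , tan) with startPt-injective m∈ l̄∈ (sym pt)
  ... | refl = tangentAt-reversed (ccwEnd Q) tan

  link-determined : ∀ {l m} → l ∈ links T → m ∈ links T → centre l ≡ centre m → quad l ≡ quad m → l ≡ m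
  link-determined {olink _ _ true}  {olink _ _ true}  _  _  refl refl = refl
  link-determined {olink _ _ false} {olink _ _ false} _  _  refl refl = refl
  link-determined {olink _ _ true}  {olink _ _ false} l∈ m∈ refl refl = ⊥-elim (reversal-absent l∈ m∈)
  link-determined {olink _ _ false} {olink _ _ true}  l∈ m∈ refl refl = ⊥-elim (reversal-absent m∈ l∈)

  linkedᵇ-true⇒∃ : ∀ {c Q} → linkedᵇ c Q ≡ true → ∃[ l ] (l ∈ links T × centre l ≡ c × quad l ≡ Q)
  linkedᵇ-true⇒∃ {c} {Q} odd =
    let (l , l∈ , is) = parity-true⇒∃ {f = isQuarterᵇ c Q} (links T) odd in
    l , l∈ , isQuarterᵇ-sound c Q l is

  linkedᵇ-link : ∀ {l} → l ∈ links T → linkedᵇ (centre l) (quad l) ≡ true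
  linkedᵇ-link {l} l∈ =
    parity-single {f = isQuarterᵇ (centre l) (quad l)} (Unique.map⁻ simple) l∈ (isQuarterᵇ-complete l)
      λ {m} m∈ is → let (c≡ , q≡) = isQuarterᵇ-sound _ _ m is in link-determined m∈ l∈ c≡ q≡

  linkedᵇ⇔HasLink : ∀ c Q → (linkedᵇ c Q ≡ true) ⇔ HasLink T c Q
  linkedᵇ⇔HasLink c Q = mk⇔
    (λ odd → let (l , l∈ , c≡ , q≡) = linkedᵇ-true⇒∃ odd in lose l∈ (c≡ , q≡))
    (λ has → let (l , l∈ , c≡ , q≡) = find has in subst₂ (λ c Q → linkedᵇ c Q ≡ true) c≡ q≡ (linkedᵇ-link l∈))

  ¬IsCentre⇒¬linked : ∀ {c} Q → ¬ IsCentre c → linkedᵇ c Q ≡ false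
  ¬IsCentre⇒¬linked {c} Q c∉ = parity-false {f = isQuarterᵇ c Q} λ {l} l∈ → ≢true⇒≡false λ is →
    c∉ (subst IsCentre (proj₁ (isQuarterᵇ-sound c Q l is)) (centre-IsCentre l∈))

  inside-east : ∀ q → insideᵇ q xor insideᵇ (q ⊕ (+ 1 , + 0)) ≡ linkedᵇ q qE xor linkedᵇ (q ⊕ (+ 1 , + 0)) qW
  inside-east q = begin
    insideᵇ q xor insideᵇ q′
      ≡⟨ parity-xor (crossesRayᵇ q) (crossesRayᵇ q′) (links T) ⟨
    parity (λ l → crossesRayᵇ q l xor crossesRayᵇ q′ l) (links T)
      ≡⟨ parity-cong (crossesRay-east q) (links T) ⟩
    parity (λ l → isQuarterᵇ q qE l xor isQuarterᵇ q′ qW l) (links T)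
      ≡⟨ parity-xor (isQuarterᵇ q qE) (isQuarterᵇ q′ qW) (links T) ⟩
    linkedᵇ q qE xor linkedᵇ q′ qW
      ∎
    where
    open ≡-Reasoning
    q′ = q ⊕ (+ 1 , + 0)

  -- Every intercardinal point of T is the start of one link and the end of another.
  endpoints-cancel : (f : Point → Bool) → parity (λ l → f (startPt l) xor f (endPt l)) (links T) ≡ false
  endpoints-cancel f = begin
    parity (λ l → f (startPt l) xor f (endPt l)) (links T)
      ≡⟨ parity-xor (f ∘ startPt) (f ∘ endPt) (links T) ⟩
    parity (f ∘ startPt) (links T) xor parity (f ∘ endPt) (links T)
      ≡⟨ cong (parity (f ∘ startPt) (links T) xor_) ends≡starts ⟩
    parity (f ∘ startPt) (links T) xor parity (f ∘ startPt) (links T)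
      ≡⟨ xor-same (parity (f ∘ startPt) (links T)) ⟩
    false
      ∎
    where
    open ≡-Reasoning
    ends≡starts : parity (f ∘ endPt) (links T) ≡ parity (f ∘ startPt) (links T)
    ends≡starts = begin
      parity (f ∘ endPt) (links T)                ≡⟨ parity-map f endPt (links T) ⟨
      parity f (map endPt (links T))              ≡⟨ cong (parity f) endPts≡rotated-startPts ⟩
      parity f (map startPt (rest ++ [ first ]))  ≡⟨ parity-map f startPt (rest ++ [ first ]) ⟩
      parity (f ∘ startPt) (rest ++ [ first ])    ≡⟨ parity-↭ (f ∘ startPt) rotation ⟨
      parity (f ∘ startPt) (links T)              ∎

  inside-north : ∀ q → insideᵇ q xor insideᵇ (q ⊕ (+ 0 , + 1)) ≡ linkedᵇ q qN xor linkedᵇ (q ⊕ (+ 0 , + 1)) qS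
  inside-north q = begin
    insideᵇ q xor insideᵇ q′
      ≡⟨ parity-xor (crossesRayᵇ q) (crossesRayᵇ q′) (links T) ⟨
    parity (λ l → crossesRayᵇ q l xor crossesRayᵇ q′ l) (links T)
      ≡⟨ parity-cong (crossesRay-north q) (links T) ⟩
    parity (λ l → quarters l xor ends l) (links T)
      ≡⟨ parity-xor quarters ends (links T) ⟩
    parity quarters (links T) xor parity ends (links T)
      ≡⟨ cong (parity quarters (links T) xor_) (endpoints-cancel (onMidRayᵇ q)) ⟩
    parity quarters (links T) xor false
      ≡⟨ xor-identityʳ (parity quarters (links T)) ⟩
    parity quarters (links T)
      ≡⟨ parity-xor (isQuarterᵇ q qN) (isQuarterᵇ q′ qS) (links T) ⟩
    linkedᵇ q qN xor linkedᵇ q′ qS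
      ∎
    where
    open ≡-Reasoning
    q′ = q ⊕ (+ 0 , + 1)
    quarters ends : OLink → Bool
    quarters l = isQuarterᵇ q qN l xor isQuarterᵇ q′ qS l
    ends l = onMidRayᵇ q (startPt l) xor onMidRayᵇ q (endPt l)

  private
    across-ahead : ∀ {c} Q → IsCentre c →
      insideᵇ c xor insideᵇ (c ⊕ outward Q) ≡ linkedᵇ c Q xor linkedᵇ (c ⊕ outward Q) (oppositeQuad Q) →
      insideᵇ c xor insideᵇ (c ⊕ outward Q) ≡ linkedᵇ c Q
    across-ahead {c} Q c∈ step = trans step (trans
      (cong (linkedᵇ c Q xor_) (¬IsCentre⇒¬linked (oppositeQuad Q) (¬IsCentre-⊕-outward Q c∈)))
      (xor-identityʳ (linkedᵇ c Q)))

    across-behind : ∀ {c} Q → IsCentre c → let w = c ⊕ outward Q ; Q′ = oppositeQuad Q in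
      insideᵇ w xor insideᵇ (w ⊕ outward Q′) ≡ linkedᵇ w Q′ xor linkedᵇ (w ⊕ outward Q′) Q →
      insideᵇ c xor insideᵇ w ≡ linkedᵇ c Q
    across-behind {c} Q c∈ step = begin
      insideᵇ c xor insideᵇ w
        ≡⟨ xor-comm (insideᵇ c) (insideᵇ w) ⟩
      insideᵇ w xor insideᵇ c
        ≡⟨ cong (λ z → insideᵇ w xor insideᵇ z) (⊕-outward-back c Q) ⟨
      insideᵇ w xor insideᵇ (w ⊕ outward Q′)
        ≡⟨ step ⟩
      linkedᵇ w Q′ xor linkedᵇ (w ⊕ outward Q′) Q
        ≡⟨ cong₂ _xor_ (¬IsCentre⇒¬linked Q′ (¬IsCentre-⊕-outward Q c∈))
                       (cong (λ z → linkedᵇ z Q) (⊕-outward-back c Q)) ⟩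
      linkedᵇ c Q
        ∎
      where
      open ≡-Reasoning
      w = c ⊕ outward Q
      Q′ = oppositeQuad Q

  inside-across : ∀ {c} Q → IsCentre c → insideᵇ c xor insideᵇ (c ⊕ outward Q) ≡ linkedᵇ c Q
  inside-across qN c∈ = across-ahead qN c∈ (inside-north _)
  inside-across qE c∈ = across-ahead qE c∈ (inside-east _)
  inside-across qS c∈ = across-behind qS c∈ (inside-north _)
  inside-across qW c∈ = across-behind qW c∈ (inside-east _)

  inside-diagonal : ∀ {c} i → IsCentre c → IsCentre (c ⊕ offset i) →
    insideᵇ c xor insideᵇ (c ⊕ offset i)
      ≡ linkedᵇ c (horizQuad i) xor linkedᵇ (c ⊕ offset i) (vertQuad (opposite i))
  inside-diagonal {c} i c∈ d∈ = begin
    insideᵇ c xor insideᵇ d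
      ≡⟨ xor-via (insideᵇ c) (insideᵇ d) (insideᵇ g) ⟩
    (insideᵇ c xor insideᵇ g) xor (insideᵇ d xor insideᵇ g)
      ≡⟨ cong₂ _xor_ (inside-across (horizQuad i) c∈) d-side ⟩
    linkedᵇ c (horizQuad i) xor linkedᵇ d (vertQuad (opposite i))
      ∎
    where
    open ≡-Reasoning
    d = c ⊕ offset i
    g = c ⊕ outward (horizQuad i)
    d-side : insideᵇ d xor insideᵇ g ≡ linkedᵇ d (vertQuad (opposite i))
    d-side = subst (λ z → insideᵇ d xor insideᵇ z ≡ linkedᵇ d (vertQuad (opposite i)))
                   (diagonal-⊕-outward c i) (inside-across (vertQuad (opposite i)) d∈)

  links-at-junction : ∀ {a b n j} → a ∈ links T → b ∈ links T → Joins a b → n ∈ links T →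
    endPt a ≡ position (centre n) j → j ≡ ccwStart (quad n) ⊎ j ≡ ccwEnd (quad n) → n ≡ a ⊎ n ≡ b
  links-at-junction {n = n} a∈ b∈ (pt , _) n∈ at j-end with start-or-end n j-end
  ... | inj₁ s = inj₂ (startPt-injective n∈ b∈ (trans (cong (position (centre n)) s) (trans (sym at) pt)))
  ... | inj₂ e = inj₁ (endPt-injective n∈ a∈ (trans (cong (position (centre n)) e) (sym at)))

  unlinked-at-junction : ∀ {a b c Q j} → a ∈ links T → b ∈ links T → Joins a b →
    endPt a ≡ position c j → j ≡ ccwStart Q ⊎ j ≡ ccwEnd Q → quad a ≢ Q → quad b ≢ Q → linkedᵇ c Q ≡ false
  unlinked-at-junction {c = c} {Q} {j} a∈ b∈ joins at j-end a≢ b≢ =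
    parity-false {f = isQuarterᵇ c Q} λ {n} n∈ → ≢true⇒≡false λ is →
      let (c≡ , q≡) = isQuarterᵇ-sound c Q n is in
      [ (λ n≡a → a≢ (trans (cong quad (sym n≡a)) q≡)) , (λ n≡b → b≢ (trans (cong quad (sym n≡b)) q≡)) ]′
        (links-at-junction a∈ b∈ joins n∈ (trans at (cong (λ z → position z j) (sym c≡)))
                           (subst (λ Q → j ≡ ccwStart Q ⊎ j ≡ ccwEnd Q) (sym q≡) j-end))

  -- The path from centre a to centre (crossing a) through a gap crosses two
  -- quarters; one is a or crossing a, the other passes through the junction
  -- point without being a link.
  inside-flips-at-crossing : ∀ {a} → a ∈ links T → crossing a ∈ links T → Joins a (crossing a) →
    insideᵇ (centre a) xor insideᵇ (centre (crossing a)) ≡ true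
  inside-flips-at-crossing {a} a∈ b∈ joins =
    trans (inside-diagonal i (centre-IsCentre a∈) (centre-IsCentre b∈)) (quarters (quad-at-endICP a))
    where
    i = endICP a
    c = centre a
    d = centre (crossing a)
    quarters : quad a ≡ horizQuad i ⊎ quad a ≡ vertQuad i →
      linkedᵇ c (horizQuad i) xor linkedᵇ d (vertQuad (opposite i)) ≡ true
    quarters (inj₁ horiz) = cong₂ _xor_
      (subst (λ Q → linkedᵇ c Q ≡ true) horiz (linkedᵇ-link a∈))
      (unlinked-at-junction a∈ b∈ joins (trans (proj₁ joins) (cong (position d) (startICP-crossing a)))
        (vertQuad-ends (opposite i))
        (λ e → horizQuad≢vertQuad∘opposite i (trans (sym horiz) e))
        (λ e → horizQuad≢vertQuad (opposite i) (trans (sym b-horiz) e)))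
      where
      b-horiz : quad (crossing a) ≡ horizQuad (opposite i)
      b-horiz = trans (cong oppositeQuad horiz) (oppositeQuad∘horizQuad i)
    quarters (inj₂ vert) = cong₂ _xor_
      (unlinked-at-junction a∈ b∈ joins refl (horizQuad-ends i)
        (λ e → horizQuad≢vertQuad i (trans (sym e) vert))
        (λ e → horizQuad≢vertQuad∘opposite i (trans (sym e) b-vert)))
      (subst (λ Q → linkedᵇ d Q ≡ true) b-vert (linkedᵇ-link b∈))
      where
      b-vert : quad (crossing a) ≡ vertQuad (opposite i)
      b-vert = trans (cong oppositeQuad vert) (oppositeQuad∘vertQuad i)

  successor-on-same-circle : ∀ {a b Q} → a ∈ links T → b ∈ links T → Joins a b →
    linkedᵇ (centre a) Q ≡ true → endICP a ≡ ccwStart Q ⊎ endICP a ≡ ccwEnd Q → quad a ≢ Q →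
    centre b ≡ centre a
  successor-on-same-circle {a} a∈ b∈ joins odd ends a≢ with linkedᵇ-true⇒∃ odd
  ... | n , n∈ , c≡ , q≡
    with links-at-junction a∈ b∈ joins n∈ (cong (λ z → position z (endICP a)) (sym c≡))
           (subst (λ Q → endICP a ≡ ccwStart Q ⊎ endICP a ≡ ccwEnd Q) (sym q≡) ends)
  ... | inj₁ n≡a = ⊥-elim (a≢ (trans (cong quad (sym n≡a)) q≡))
  ... | inj₂ n≡b = trans (cong centre (sym n≡b)) c≡

  xor-linked⇔ : ∀ {A B} QA QB → (IsCentre A → ¬ IsCentre B) →
    (linkedᵇ A QA xor linkedᵇ B QB ≡ true)
      ⇔ (∃[ l ] (l ∈ links T × ((centre l ≡ A × quad l ≡ QA) ⊎ (centre l ≡ B × quad l ≡ QB))))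
  xor-linked⇔ {A} {B} QA QB apart = mk⇔ to from
    where
    to : linkedᵇ A QA xor linkedᵇ B QB ≡ true →
      ∃[ l ] (l ∈ links T × ((centre l ≡ A × quad l ≡ QA) ⊎ (centre l ≡ B × quad l ≡ QB)))
    to odd with linkedᵇ A QA in A-odd | linkedᵇ B QB in B-odd
    ... | true  | false = let (l , l∈ , at) = linkedᵇ-true⇒∃ A-odd in l , l∈ , inj₁ at
    ... | false | true  = let (l , l∈ , at) = linkedᵇ-true⇒∃ B-odd in l , l∈ , inj₂ at
    from : ∃[ l ] (l ∈ links T × ((centre l ≡ A × quad l ≡ QA) ⊎ (centre l ≡ B × quad l ≡ QB))) →
      linkedᵇ A QA xor linkedᵇ B QB ≡ true
    from (l , l∈ , inj₁ (c≡ , q≡)) = cong₂ _xor_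
      (subst₂ (λ c Q → linkedᵇ c Q ≡ true) c≡ q≡ (linkedᵇ-link l∈))
      (¬IsCentre⇒¬linked QB (apart (subst IsCentre c≡ (centre-IsCentre l∈))))
    from (l , l∈ , inj₂ (c≡ , q≡)) = cong₂ _xor_
      (¬IsCentre⇒¬linked QA (λ A∈ → apart A∈ (subst IsCentre c≡ (centre-IsCentre l∈))))
      (subst₂ (λ c Q → linkedᵇ c Q ≡ true) c≡ q≡ (linkedᵇ-link l∈))

  module LatticeOfT (ℓ : Lattice) (ℓ-is-LT : IsLT T ℓ) where

    InsideIffInLattice : Point → Set
    InsideIffInLattice c = (insideᵇ c ≡ true) ⇔ InLattice ℓ c

    -- Along a crossing both the side of T and the lattice of the centre change.
    InsideIffInLattice-step : ∀ {a b} → a ∈ links T → b ∈ links T → Joins a b →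
      InsideIffInLattice (centre a) → InsideIffInLattice (centre b)
    InsideIffInLattice-step {a} a∈ b∈ joins a-ok with Joins-cases joins
    ... | inj₁ same = subst InsideIffInLattice (sym same) a-ok
    ... | inj₂ refl = mk⇔ to from
      where
      flips = inside-flips-at-crossing a∈ b∈ joins
      odd₁ = proj₁ (offset-odd (endICP a))
      odd₂ = proj₂ (offset-odd (endICP a))
      to : insideᵇ (centre (crossing a)) ≡ true → InLattice ℓ (centre (crossing a))
      to b-in = ¬InLattice-⊕-odd ℓ (centre-IsCentre a∈) a∉ℓ odd₁ odd₂
        where
        a∉ℓ : ¬ InLattice ℓ (centre a)
        a∉ℓ a∈ℓ = false≢true
          (trans (sym (trans (xor-true⇒≡not _ flips) (cong not (Equivalence.from a-ok a∈ℓ)))) b-in)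
      from : InLattice ℓ (centre (crossing a)) → insideᵇ (centre (crossing a)) ≡ true
      from b∈ℓ = trans (xor-true⇒≡not _ flips) (cong not a-out)
        where
        a-out : insideᵇ (centre a) ≡ false
        a-out = ≢true⇒≡false λ a-in → InLattice-⊕-odd ℓ (Equivalence.to a-ok a-in) odd₁ odd₂ b∈ℓ

    inside⇔InLattice : ∀ {l} → l ∈ links T → InsideIffInLattice (centre l)
    inside⇔InLattice l∈ =
      let (l₀ , l₀∈ , l₀-inside , l₀∈ℓ) = ℓ-is-LT in
      along-tangle (InsideIffInLattice ∘ centre) InsideIffInLattice-step l₀∈ l∈
        (mk⇔ (λ _ → l₀∈ℓ) (λ _ → Equivalence.to (DiskInside⇔insideᵇ _) l₀-inside))

    linked⇒inside : ∀ {c Q} → linkedᵇ c Q ≡ true → InLattice ℓ c → insideᵇ c ≡ true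
    linked⇒inside odd c∈ℓ with linkedᵇ-true⇒∃ odd
    ... | l , l∈ , refl , _ = Equivalence.from (inside⇔InLattice l∈) c∈ℓ

    linked⇒outside : ∀ {c Q} → linkedᵇ c Q ≡ true → ¬ InLattice ℓ c → insideᵇ c ≡ false
    linked⇒outside odd c∉ℓ with linkedᵇ-true⇒∃ odd
    ... | l , l∈ , refl , _ = ≢true⇒≡false (c∉ℓ ∘ Equivalence.to (inside⇔InLattice l∈))

    -- Otherwise T would be that single circle, whose centre is not in L_T.
    ¬all-quarters-linked : ∀ {d} → ¬ InLattice ℓ d → ¬ (∀ Q → linkedᵇ d Q ≡ true)
    ¬all-quarters-linked {d} d∉ℓ all-linked =
      let (l , l∈ , l-at-d , _) = linkedᵇ-true⇒∃ (all-linked qN)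
          (l₀ , l₀∈ , _ , l₀∈ℓ) = ℓ-is-LT in
      d∉ℓ (subst (InLattice ℓ) (along-tangle (λ m → centre m ≡ d) step l∈ l₀∈ l-at-d) l₀∈ℓ)
      where
      step : ∀ {a b} → a ∈ links T → b ∈ links T → Joins a b → centre a ≡ d → centre b ≡ d
      step {a} a∈ b∈ joins a-at-d =
        let (Q , ends , a≢) = other-quarter-at-end a in
        trans (successor-on-same-circle a∈ b∈ joins
                 (subst (λ z → linkedᵇ z Q ≡ true) (sym a-at-d) (all-linked Q)) ends a≢) a-at-d

    inside-beyond⇔ : ∀ {v} Q → InLattice ℓ v →
      (insideᵇ v ≡ true × linkedᵇ v Q ≡ false) ⇔ (insideᵇ (v ⊕ outward Q) ≡ true)
    inside-beyond⇔ {v} Q v∈ℓ = mk⇔ to from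
      where
      across : insideᵇ v xor insideᵇ (v ⊕ outward Q) ≡ linkedᵇ v Q
      across = inside-across Q (InLattice⇒IsCentre ℓ v∈ℓ)
      beyond≡ : insideᵇ (v ⊕ outward Q) ≡ insideᵇ v xor linkedᵇ v Q
      beyond≡ = xor-solveʳ (insideᵇ v) across
      to : insideᵇ v ≡ true × linkedᵇ v Q ≡ false → insideᵇ (v ⊕ outward Q) ≡ true
      to (v-in , unlinked) = trans beyond≡ (cong₂ _xor_ v-in unlinked)
      from : insideᵇ (v ⊕ outward Q) ≡ true → insideᵇ v ≡ true × linkedᵇ v Q ≡ false
      from beyond-in =
        trans (xor-solveˡ (insideᵇ (v ⊕ outward Q)) across) (cong₂ _xor_ beyond-in unlinked) , unlinked
        where
        unlinked : linkedᵇ v Q ≡ false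
        unlinked = ≢true⇒≡false λ odd →
          false≢true (trans (sym (trans beyond≡ (cong₂ _xor_ (linked⇒inside odd v∈ℓ) odd))) beyond-in)

    edge⇔ : ∀ {v w} Q → InLattice ℓ v → InLattice ℓ w → v ⊕ outward Q ≡ w ⊕ outward (oppositeQuad Q) →
      (Vertex T ℓ v × Vertex T ℓ w × ¬ (HasLink T v Q ⊎ HasLink T w (oppositeQuad Q)))
        ⇔ (insideᵇ (v ⊕ outward Q) ≡ true)
    edge⇔ {v} {w} Q v∈ℓ w∈ℓ meet = mk⇔ to from
      where
      unlinked : ∀ {c Q} → ¬ HasLink T c Q → linkedᵇ c Q ≡ false
      unlinked {c} {Q} no-link = ≢true⇒≡false (no-link ∘ Equivalence.to (linkedᵇ⇔HasLink c Q))
      no-link : ∀ {c Q} → linkedᵇ c Q ≡ false → ¬ HasLink T c Q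
      no-link {c} {Q} unl has = false≢true (trans (sym unl) (Equivalence.from (linkedᵇ⇔HasLink c Q) has))
      to : Vertex T ℓ v × Vertex T ℓ w × ¬ (HasLink T v Q ⊎ HasLink T w (oppositeQuad Q)) →
        insideᵇ (v ⊕ outward Q) ≡ true
      to ((_ , v-in) , _ , no-links) = Equivalence.to (inside-beyond⇔ Q v∈ℓ)
        (Equivalence.to (DiskInside⇔insideᵇ v) v-in , unlinked (no-links ∘ inj₁))
      from : insideᵇ (v ⊕ outward Q) ≡ true →
        Vertex T ℓ v × Vertex T ℓ w × ¬ (HasLink T v Q ⊎ HasLink T w (oppositeQuad Q))
      from g-in =
        let (v-in , v-unl) = Equivalence.from (inside-beyond⇔ Q v∈ℓ) g-in
            (w-in , w-unl) = Equivalence.from (inside-beyond⇔ (oppositeQuad Q) w∈ℓ)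
                                              (subst (λ g → insideᵇ g ≡ true) meet g-in)
        in (v∈ℓ , Equivalence.from (DiskInside⇔insideᵇ v) v-in)
         , (w∈ℓ , Equivalence.from (DiskInside⇔insideᵇ w) w-in)
         , [ no-link v-unl , no-link w-unl ]′

    HEdge⇔ : ∀ {v} → InLattice ℓ v → HEdge T ℓ v ⇔ (insideᵇ (v ⊕ outward qE) ≡ true)
    HEdge⇔ {v} v∈ℓ = edge⇔ qE v∈ℓ (InLattice-⊕-even ℓ v∈ℓ (+ 1 , refl) (+ 0 , refl)) (⊕-regroup v refl)

    VEdge⇔ : ∀ {v} → InLattice ℓ v → VEdge T ℓ v ⇔ (insideᵇ (v ⊕ outward qN) ≡ true)
    VEdge⇔ {v} v∈ℓ = edge⇔ qN v∈ℓ (InLattice-⊕-even ℓ v∈ℓ (+ 0 , refl) (+ 1 , refl)) (⊕-regroup v refl)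

    around⇔inside : ∀ {d} → IsCentre d → ¬ InLattice ℓ d →
      (∀ Q → insideᵇ (d ⊕ outward Q) ≡ true) ⇔ (insideᵇ d ≡ true)
    around⇔inside {d} d∈ d∉ℓ = mk⇔ to from
      where
      to : (∀ Q → insideᵇ (d ⊕ outward Q) ≡ true) → insideᵇ d ≡ true
      to around with insideᵇ d in d-in
      ... | true  = refl
      ... | false = ⊥-elim (¬all-quarters-linked d∉ℓ λ Q →
                      trans (sym (inside-across Q d∈)) (cong₂ _xor_ d-in (around Q)))
      from : insideᵇ d ≡ true → ∀ Q → insideᵇ (d ⊕ outward Q) ≡ true
      from d-in Q = trans (xor-solveʳ (insideᵇ d) (inside-across Q d∈)) (cong₂ _xor_ d-in unlinked)
        where
        unlinked : linkedᵇ d Q ≡ false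
        unlinked = ≢true⇒≡false λ odd → false≢true (trans (sym (linked⇒outside odd d∉ℓ)) d-in)

    DSquare⇔ : ∀ {v} → InLattice ℓ v → DSquare T ℓ v ⇔ (insideᵇ (v ⊕ (+ 1 , + 1)) ≡ true)
    DSquare⇔ {v} v∈ℓ = mk⇔ to from
      where
      inside : Point → Set
      inside g = insideᵇ g ≡ true
      d vN vE : Point
      d = v ⊕ (+ 1 , + 1)
      vN = v ⊕ (+ 0 , + 2)
      vE = v ⊕ (+ 2 , + 0)
      vN∈ℓ : InLattice ℓ vN
      vN∈ℓ = InLattice-⊕-even ℓ v∈ℓ (+ 0 , refl) (+ 1 , refl)
      vE∈ℓ : InLattice ℓ vE
      vE∈ℓ = InLattice-⊕-even ℓ v∈ℓ (+ 1 , refl) (+ 0 , refl)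
      atS : d ⊕ outward qS ≡ v ⊕ outward qE
      atS = ⊕-assoc v (+ 1 , + 1) (outward qS)
      atW : d ⊕ outward qW ≡ v ⊕ outward qN
      atW = ⊕-assoc v (+ 1 , + 1) (outward qW)
      atN : d ⊕ outward qN ≡ vN ⊕ outward qE
      atN = trans (⊕-assoc v (+ 1 , + 1) (outward qN)) (sym (⊕-assoc v (+ 0 , + 2) (outward qE)))
      atE : d ⊕ outward qE ≡ vE ⊕ outward qN
      atE = trans (⊕-assoc v (+ 1 , + 1) (outward qE)) (sym (⊕-assoc v (+ 2 , + 0) (outward qN)))
      around : (∀ Q → inside (d ⊕ outward Q)) ⇔ inside d
      around = around⇔inside (IsCentre-⊕-odd (InLattice⇒IsCentre ℓ v∈ℓ) (+ 0 , refl) (+ 0 , refl))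
                             (InLattice-⊕-odd ℓ v∈ℓ (+ 0 , refl) (+ 0 , refl))
      to : DSquare T ℓ v → inside d
      to (s , n , w , e) = Equivalence.to around λ
        { qS → subst inside (sym atS) (Equivalence.to (HEdge⇔ v∈ℓ) s)
        ; qN → subst inside (sym atN) (Equivalence.to (HEdge⇔ vN∈ℓ) n)
        ; qW → subst inside (sym atW) (Equivalence.to (VEdge⇔ v∈ℓ) w)
        ; qE → subst inside (sym atE) (Equivalence.to (VEdge⇔ vE∈ℓ) e) }
      from : inside d → DSquare T ℓ v
      from d-in = Equivalence.from (HEdge⇔ v∈ℓ)  (subst inside atS (around-in qS))
                , Equivalence.from (HEdge⇔ vN∈ℓ) (subst inside atN (around-in qN))
                , Equivalence.from (VEdge⇔ v∈ℓ)  (subst inside atW (around-in qW))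
                , Equivalence.from (VEdge⇔ vE∈ℓ) (subst inside atE (around-in qE))
        where
        around-in : ∀ Q → inside (d ⊕ outward Q)
        around-in = Equivalence.from around d-in

    module FleronPolyomino (p : Point) (p∈ℓ : InLattice ℓ p) where

      vertex-at : ∀ i j → InLattice ℓ (p ⊕ (+ 2 * i , + 2 * j))
      vertex-at i j = InLattice-⊕-even ℓ p∈ℓ (i , double i) (j , double j)

      east-cell : ∀ i j → (p ⊕ (+ 2 * i , + 2 * j)) ⊕ outward qE ≡ p ⊕ (+ 2 * i + + 1 , + 2 * j)
      east-cell i j = trans (⊕-assoc p (+ 2 * i , + 2 * j) (outward qE))
                            (cong (λ y → p ⊕ (+ 2 * i + + 1 , y)) (ℤ.+-identityʳ (+ 2 * j)))

      north-cell : ∀ i j → (p ⊕ (+ 2 * i , + 2 * j)) ⊕ outward qN ≡ p ⊕ (+ 2 * i , + 2 * j + + 1)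
      north-cell i j = trans (⊕-assoc p (+ 2 * i , + 2 * j) (outward qN))
                             (cong (λ x → p ⊕ (x , + 2 * j + + 1)) (ℤ.+-identityʳ (+ 2 * i)))

      diagonal-cell : ∀ i j → (p ⊕ (+ 2 * i , + 2 * j)) ⊕ (+ 1 , + 1) ≡ p ⊕ (+ 2 * i + + 1 , + 2 * j + + 1)
      diagonal-cell i j = ⊕-assoc p (+ 2 * i , + 2 * j) (+ 1 , + 1)

      Fleron⇔inside : ∀ Z → Fleron T ℓ p Z ⇔ (insideᵇ (p ⊕ Z) ≡ true)
      Fleron⇔inside Z = mk⇔ (to Z) (from Z)
        where
        inside : Point → Set
        inside g = insideᵇ g ≡ true
        to : ∀ Z → Fleron T ℓ p Z → inside (p ⊕ Z)
        to _ (i , j , inj₁ ((_ , v-in) , refl)) = Equivalence.to (DiskInside⇔insideᵇ _) v-in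
        to _ (i , j , inj₂ (inj₁ (edge , refl))) =
          subst inside (east-cell i j) (Equivalence.to (HEdge⇔ (vertex-at i j)) edge)
        to _ (i , j , inj₂ (inj₂ (inj₁ (edge , refl)))) =
          subst inside (north-cell i j) (Equivalence.to (VEdge⇔ (vertex-at i j)) edge)
        to _ (i , j , inj₂ (inj₂ (inj₂ (square , refl)))) =
          subst inside (diagonal-cell i j) (Equivalence.to (DSquare⇔ (vertex-at i j)) square)
        from : ∀ Z → inside (p ⊕ Z) → Fleron T ℓ p Z
        from (x , y) Z-in with halve x | halve y
        ... | i , inj₁ refl | j , inj₁ refl =
          i , j , inj₁ ((vertex-at i j , Equivalence.from (DiskInside⇔insideᵇ _) Z-in) , refl)
        ... | i , inj₂ refl | j , inj₁ refl = i , j , inj₂ (inj₁ (edge , refl))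
          where edge = Equivalence.from (HEdge⇔ (vertex-at i j)) (subst inside (sym (east-cell i j)) Z-in)
        ... | i , inj₁ refl | j , inj₂ refl = i , j , inj₂ (inj₂ (inj₁ (edge , refl)))
          where edge = Equivalence.from (VEdge⇔ (vertex-at i j)) (subst inside (sym (north-cell i j)) Z-in)
        ... | i , inj₂ refl | j , inj₂ refl = i , j , inj₂ (inj₂ (inj₂ (square , refl)))
          where square = Equivalence.from (DSquare⇔ (vertex-at i j)) (subst inside (sym (diagonal-cell i j)) Z-in)

      crossedEdge : OLink → UnitEdge
      crossedEdge l = edgeBetween (centre l ⊖ p) (quad l)

      Crosses : UnitEdge → OLink → Set
      Crosses e l = (centre l ≡ p ⊕ lowCell e × quad l ≡ lowQuad e)
                  ⊎ (centre l ≡ p ⊕ highCell e × quad l ≡ oppositeQuad (lowQuad e))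

      crossedEdge≡⇔ : ∀ l e → (crossedEdge l ≡ e) ⇔ Crosses e l
      crossedEdge≡⇔ l e = mk⇔
        (λ l↦e → Sum.map shift→ shift→ (Equivalence.to (edgeBetween≡⇔ (centre l ⊖ p) (quad l) e) l↦e))
        (λ crosses → Equivalence.from (edgeBetween≡⇔ (centre l ⊖ p) (quad l) e) (Sum.map shift← shift← crosses))
        where
        shift→ : ∀ {r} {B : Set} → (centre l ⊖ p ≡ r) × B → (centre l ≡ p ⊕ r) × B
        shift→ = Product.map₁ (Equivalence.to (⊖≡⇔≡⊕ (centre l) p _))
        shift← : ∀ {r} {B : Set} → (centre l ≡ p ⊕ r) × B → (centre l ⊖ p ≡ r) × B
        shift← = Product.map₁ (Equivalence.from (⊖≡⇔≡⊕ (centre l) p _))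

      highCell-beyond : ∀ e → p ⊕ highCell e ≡ (p ⊕ lowCell e) ⊕ outward (lowQuad e)
      highCell-beyond e = ⊕-regroup p (highCell≡lowCell⊕outward e)

      not-both-centres : ∀ e → IsCentre (p ⊕ lowCell e) → ¬ IsCentre (p ⊕ highCell e)
      not-both-centres e low∈ high∈ =
        ¬IsCentre-⊕-outward (lowQuad e) low∈ (subst IsCentre (highCell-beyond e) high∈)

      inside-across-edge : ∀ e → let A = p ⊕ lowCell e ; B = p ⊕ highCell e in
        insideᵇ A xor insideᵇ B ≡ linkedᵇ A (lowQuad e) xor linkedᵇ B (oppositeQuad (lowQuad e))
      inside-across-edge e@(hor _ _) =
        subst (λ B → insideᵇ (p ⊕ lowCell e) xor insideᵇ B ≡ linkedᵇ (p ⊕ lowCell e) qN xor linkedᵇ B qS)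
              (sym (highCell-beyond e)) (inside-north (p ⊕ lowCell e))
      inside-across-edge e@(ver _ _) =
        subst (λ B → insideᵇ (p ⊕ lowCell e) xor insideᵇ B ≡ linkedᵇ (p ⊕ lowCell e) qE xor linkedᵇ B qW)
              (sym (highCell-beyond e)) (inside-east (p ⊕ lowCell e))

      boundary⇔crossed : ∀ e → OnBoundary (Fleron T ℓ p) e ⇔ (∃[ l ] (l ∈ links T × crossedEdge l ≡ e))
      boundary⇔crossed e = mk⇔ to from
        where
        lo hi : Point
        lo = p ⊕ lowCell e
        hi = p ⊕ highCell e
        boundary⇔xor : OnBoundary (Fleron T ℓ p) e ⇔ (insideᵇ hi xor insideᵇ lo ≡ true)
        boundary⇔xor = ⇔-trans (OnBoundary⇔ (Fleron T ℓ p) e)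
          (xor-⇔ (insideᵇ hi) (insideᵇ lo) (Fleron⇔inside (highCell e)) (Fleron⇔inside (lowCell e)))
        linked⇔ : (linkedᵇ lo (lowQuad e) xor linkedᵇ hi (oppositeQuad (lowQuad e)) ≡ true)
                    ⇔ (∃[ l ] (l ∈ links T × Crosses e l))
        linked⇔ = xor-linked⇔ (lowQuad e) (oppositeQuad (lowQuad e)) (not-both-centres e)
        inside≡linked :
          insideᵇ hi xor insideᵇ lo ≡ linkedᵇ lo (lowQuad e) xor linkedᵇ hi (oppositeQuad (lowQuad e))
        inside≡linked = trans (xor-comm (insideᵇ hi) (insideᵇ lo)) (inside-across-edge e)
        to : OnBoundary (Fleron T ℓ p) e → ∃[ l ] (l ∈ links T × crossedEdge l ≡ e)
        to on = let (l , l∈ , crosses) = Equivalence.to linked⇔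
                                           (trans (sym inside≡linked) (Equivalence.to boundary⇔xor on))
                in l , l∈ , Equivalence.from (crossedEdge≡⇔ l e) crosses
        from : ∃[ l ] (l ∈ links T × crossedEdge l ≡ e) → OnBoundary (Fleron T ℓ p) e
        from (l , l∈ , l↦e) = Equivalence.from boundary⇔xor
          (trans inside≡linked (Equivalence.from linked⇔ (l , l∈ , Equivalence.to (crossedEdge≡⇔ l e) l↦e)))

      crossedEdge-injective : ∀ {l m} → l ∈ links T → m ∈ links T → crossedEdge l ≡ crossedEdge m → l ≡ m
      crossedEdge-injective {l} {m} l∈ m∈ eq =
        same-side (Equivalence.to (crossedEdge≡⇔ l e) eq) (Equivalence.to (crossedEdge≡⇔ m e) refl)
        where
        e = crossedEdge m
        same-side : Crosses e l → Crosses e m → l ≡ m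
        same-side (inj₁ (c₁ , q₁)) (inj₁ (c₂ , q₂)) =
          link-determined l∈ m∈ (trans c₁ (sym c₂)) (trans q₁ (sym q₂))
        same-side (inj₂ (c₁ , q₁)) (inj₂ (c₂ , q₂)) =
          link-determined l∈ m∈ (trans c₁ (sym c₂)) (trans q₁ (sym q₂))
        same-side (inj₁ (c₁ , _)) (inj₂ (c₂ , _)) = ⊥-elim
          (not-both-centres e (subst IsCentre c₁ (centre-IsCentre l∈)) (subst IsCentre c₂ (centre-IsCentre m∈)))
        same-side (inj₂ (c₁ , _)) (inj₁ (c₂ , _)) = ⊥-elim
          (not-both-centres e (subst IsCentre c₂ (centre-IsCentre m∈)) (subst IsCentre c₁ (centre-IsCentre l∈)))

      perimeter : HasPerimeter (Fleron T ℓ p) (tangleLength T)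
      perimeter = map crossedEdge (links T)
                , injectiveOn⇒Unique-map crossedEdge-injective (Unique.map⁻ simple)
                , (λ e → mk⇔ (listed⇒boundary e) (boundary⇒listed e))
                , length-map crossedEdge (links T)
        where
        listed⇒boundary : ∀ e → e ∈ map crossedEdge (links T) → OnBoundary (Fleron T ℓ p) e
        listed⇒boundary e e∈ = let (l , l∈ , e≡) = ∈-map⁻ crossedEdge e∈ in
          Equivalence.from (boundary⇔crossed e) (l , l∈ , sym e≡)
        boundary⇒listed : ∀ e → OnBoundary (Fleron T ℓ p) e → e ∈ map crossedEdge (links T)
        boundary⇒listed e on = let (l , l∈ , l↦e) = Equivalence.to (boundary⇔crossed e) on in
          subst (_∈ map crossedEdge (links T)) l↦e (∈-map⁺ crossedEdge l∈)

mainTheorem9 : (T : Tangle) (c : ℕ) → tangleLength T ≡ 4 ℕ.* c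
    → (ℓ : Lattice) → IsLT T ℓ → (p : Point) → InLattice ℓ p
    → HasPerimeter (Fleron T ℓ p) (4 ℕ.* c)
mainTheorem9 T c length≡4c ℓ ℓ-is-LT p p∈ℓ = subst (HasPerimeter (Fleron T ℓ p)) length≡4c perimeter
  where
  open TangleProperties T
  open LatticeOfT ℓ ℓ-is-LT
  open FleronPolyomino p p∈ℓ
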